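{- Let $d\ge 5$ and $G=P_2\,\square\,Q_d$ with canonical copies $G_1,G_2$ of $Q_d$, and let $M_1,M_2$ be matchings of $G_1,G_2$ respectively; put $M=M_1\cup M_2$. Let $u\in V(G_1)$ and $v\in V(G_2)$ have different global parities. Assume property (P$_d$) below holds. Then there exists a Hamilton path of $G$ between $u$ and $v$ containing all edges of $M$ if and only if no sequence of half-layers in $G$ contained in $M$ covers both $u$ and $v$. Moreover, when such a path exists, there are at least $2^{d-3}$ distinct Hamilton paths of $G$ between $u$ and $v$ containing $M$, each using exactly one edge between $G_1$ and $G_2$, these connecting edges being pairwise distinct. Property (P$_d$): for every matching $M'$ of $Q_d$ and every two vertices $a,b$ of opposite parity, there is a Hamilton path of $Q_d$ between $a$ and $b$ containing all edges of $M'$ if and only if none of the conditions C1, C2, C3 (for $M'$, $a$, $b$) holds.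
   Context: $Q_d$ has vertex set $\{0,1\}^d$, two vertices adjacent iff they differ in exactly one coordinate; parity of a vertex = parity of its number of ones; $x^i$ is $x$ with coordinate $i$ flipped. A half-layer in direction $i$ of $Q_d$ is a set $\{x x^i : x_i = 0,\ x \text{ has parity } p\}$ for a fixed parity $p$; a $a$-avoiding almost half-layer in direction $i$ is $H\setminus\{aa^i\}$ where $H$ is the half-layer in direction $i$ containing $aa^i$. A vertex is covered by a set of edges if it is an endpoint of one of them. For a matching $M'$ and vertices $a,b$ of opposite parity: C1: $M'$ contains a half-layer covering both $a$ and $b$. C2: there are directions $i\ne j$ with $b=a^i$, $M'$ contains the $a$-avoiding almost half-layer in direction $i$, and $aa^j, bb^j\in M'$. C3: $ab\in M'$. The graph $P_m\,\square\,Q_d$ has vertex set $\{1,\dots,m\}\times\{0,1\}^d$, with edges $(t,x)(t,x^i)$ and $(t,x)(t+1,x)$; its $t$-th canonical copy $G_t$ is the subgraph induced by $\{t\}\times\{0,1\}^d$. The global parity of $(t,x)$ is the parity of $t+|x|$ (where $|x|$ is the number of ones). A sequence of half-layers in $P_m\,\square\,Q_d$ in direction $i\in[d]$ and global parity $p$ is the edge set $\{(t,x)(t,x^i): t\in[m],\ x_i=0,\ t+|x|\equiv p \pmod 2\}$. -}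

module Defs where

open import Data.Nat using (ℕ; zero; suc)
open import Data.Bool using (Bool; true; false; not; _xor_)
open import Data.Fin using (Fin; zero; suc)
open import Data.Vec using (Vec; []; _∷_; lookup; updateAt)
open import Data.List using (List; []; _∷_; head; last)
open import Data.Maybe using (just)
open import Data.Product using (Σ; ∃; _×_; _,_)
open import Data.Sum using (_⊎_)
open import Relation.Nullary using (¬_)
open import Relation.Binary.PropositionalEquality using (_≡_; _≢_)
open import Data.List.Membership.Propositional using (_∈_)
open import Data.List.Relation.Unary.Unique.Propositional using (Unique)

-- An edge set on vertex type V: a predicate on ordered pairs; the
-- (unordered) edge xy belongs to E iff E x y or E y x.
EdgeSet : Set → Set₁
EdgeSet V = V → V → Set

_∋ₑ_─_ : {V : Set} → EdgeSet V → V → V → Set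
E ∋ₑ x ─ y = E x y ⊎ E y x

IsMatching : {V : Set} → (V → V → Set) → EdgeSet V → Set
IsMatching {V} Adj E =
  ((x y : V) → E x y → Adj x y) ×
  ((x y z : V) → E ∋ₑ x ─ y → E ∋ₑ x ─ z → y ≡ z)

data Consec {V : Set} : List V → V → V → Set where
  here  : ∀ {x y rest} → Consec (x ∷ y ∷ rest) x y
  there : ∀ {z rest x y} → Consec rest x y → Consec (z ∷ rest) x y

UsesEdge : {V : Set} → List V → V → V → Set
UsesEdge p x y = Consec p x y ⊎ Consec p y x

IsHamPath : {V : Set} → (V → V → Set) → V → V → List V → Set
IsHamPath {V} Adj u v p =
  head p ≡ just u × last p ≡ just v × Unique p ×
  ((w : V) → w ∈ p) ×
  ((x y : V) → Consec p x y → Adj x y)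

ContainsEdges : {V : Set} → List V → EdgeSet V → Set
ContainsEdges {V} p E = (x y : V) → E x y → UsesEdge p x y

QV : ℕ → Set
QV d = Vec Bool d

flip : ∀ {d} → Fin d → QV d → QV d
flip i x = updateAt x i not

QAdj : ∀ {d} → QV d → QV d → Set
QAdj {d} x y = Σ (Fin d) λ i → y ≡ flip i x

parity : ∀ {d} → QV d → Bool
parity [] = false
parity (b ∷ x) = b xor parity x

HalfLayer : ∀ {d} → Fin d → Bool → EdgeSet (QV d)
HalfLayer i p x y = lookup x i ≡ false × parity x ≡ p × y ≡ flip i x

Covers : {V : Set} → EdgeSet V → V → Set
Covers F a = ∃ λ x → ∃ λ y → F x y × (a ≡ x ⊎ a ≡ y)

_⊆ₑ_ : {V : Set} → EdgeSet V → EdgeSet V → Set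
_⊆ₑ_ {V} F E = (x y : V) → F x y → E ∋ₑ x ─ y

-- a-avoiding almost half-layer in direction i: H \ {a a^i}, H the
-- half-layer in direction i containing a a^i
AlmostHalfLayer : ∀ {d} → Fin d → QV d → EdgeSet (QV d)
AlmostHalfLayer i a x y =
  Σ Bool λ p → (HalfLayer i p ∋ₑ a ─ flip i a) × HalfLayer i p x y ×
    ¬ (x ≡ a ⊎ x ≡ flip i a)

C1 : ∀ {d} → EdgeSet (QV d) → QV d → QV d → Set
C1 {d} M a b = Σ (Fin d) λ i → Σ Bool λ p →
  (HalfLayer i p ⊆ₑ M) × Covers (HalfLayer i p) a × Covers (HalfLayer i p) b

C2 : ∀ {d} → EdgeSet (QV d) → QV d → QV d → Set
C2 {d} M a b = Σ (Fin d) λ i → Σ (Fin d) λ j →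
  i ≢ j × b ≡ flip i a × (AlmostHalfLayer i a ⊆ₑ M) ×
  (M ∋ₑ a ─ flip j a) × (M ∋ₑ b ─ flip j b)

C3 : ∀ {d} → EdgeSet (QV d) → QV d → QV d → Set
C3 M a b = M ∋ₑ a ─ b

PropertyP : ℕ → Set₁
PropertyP d = (M : EdgeSet (QV d)) → IsMatching QAdj M →
  (a b : QV d) → parity a ≢ parity b →
  ((Σ (List (QV d)) λ p → IsHamPath QAdj a b p × ContainsEdges p M) →
      ¬ (C1 M a b ⊎ C2 M a b ⊎ C3 M a b)) ×
  (¬ (C1 M a b ⊎ C2 M a b ⊎ C3 M a b) →
      Σ (List (QV d)) λ p → IsHamPath QAdj a b p × ContainsEdges p M)

-- P_2 □ Q_d ; layer zero ↔ t = 1, layer (suc zero) ↔ t = 2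

GV : ℕ → Set
GV d = Fin 2 × QV d

GAdj : ∀ {d} → GV d → GV d → Set
GAdj (s , x) (t , y) = (s ≡ t × QAdj x y) ⊎ (x ≡ y × s ≢ t)

-- parity of t (true = odd) for t = toℕ s + 1
layerParity : Fin 2 → Bool
layerParity zero = true
layerParity (suc _) = false

globalParity : ∀ {d} → GV d → Bool
globalParity (t , x) = layerParity t xor parity x

unionM : ∀ {d} → EdgeSet (QV d) → EdgeSet (QV d) → EdgeSet (GV d)
unionM M₁ M₂ (s , x) (t , y) =
  (s ≡ zero × t ≡ zero × M₁ x y) ⊎ (s ≡ suc zero × t ≡ suc zero × M₂ x y)

SeqHalfLayers : ∀ {d} → Fin d → Bool → EdgeSet (GV d)
SeqHalfLayers i p (s , x) (t , y) =
  s ≡ t × lookup x i ≡ false × globalParity (s , x) ≡ p × y ≡ flip i x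

UsesExactlyCrossing : ∀ {d} → List (GV d) → QV d → Set
UsesExactlyCrossing {d} p x =
  UsesEdge p (zero , x) (suc zero , x) ×
  ((y : QV d) → UsesEdge p (zero , y) (suc zero , y) → y ≡ x)

-- Colour the vertices covered by the sequence of half-layers.  Two
-- adjacent vertices of the same colour are the ends of an edge in the direction of the
-- sequence, so along a Hamilton path containing the sequence the coloured vertices come
-- in adjacent pairs and the uncoloured ones in runs of length at most two; with both
-- ends coloured, the path has at least two more coloured than uncoloured vertices.  But
-- the two copies of Q_d are coloured complementarily, so exactly half are coloured.
--
-- A Hamilton path of G from u to v crossing only at (1,x)(2,x)
-- is a Hamilton path of G₁ from u to x containing M₁ followed by one of G₂ from x to v
-- containing M₂, and by (P_d) these exist when x has the parity opposite to u and none
-- of C1–C3 holds for (M₁, u, x) and (M₂, x, v).  If M₁ contains the half-layer in some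
-- direction k through u, this holds for every x off that half-layer; if it contains no
-- half-layer through u, for every x not adjacent to u; likewise for v.  Counting the
-- vertices of Q_d with prescribed parity and coordinates gives 2^(d-3) such x in every
-- case, except when both are half-layers in one direction k with different parities,
-- and then these two form a sequence of half-layers covering u and v.
--
-- Whether a half-layer lies in a matching is not decidable, but (P_d) itself implies
-- ¬ A ⊎ ¬ ¬ A for every A, which suffices since C1–C3 only have to be refuted.
module Submission where

open import Defs
open import Data.Bool using (Bool; true; false; not; _xor_)
open import Data.Bool.Properties
  using (not-involutive; not-¬; ¬-not; not-distribˡ-xor; not-distribʳ-xor; xor-assoc; xor-same; xor-identityʳ)
  renaming (_≟_ to _≟ᵇ_)
open import Data.Empty using (⊥-elim)
open import Data.Fin using (Fin; zero; suc; inject≤; fromℕ<)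
open import Data.Fin.Properties using (injective⇒≤; inject≤-injective) renaming (_≟_ to _≟ᶠ_)
open import Data.List using (List; []; _∷_; _++_; map; length; filter; head; last; allFin)
import Data.List as List
open import Data.List.Membership.Propositional using (_∈_; _∉_; lose)
open import Data.List.Membership.Propositional.Properties
  using (∈-map⁺; ∈-map⁻; ∈-++⁺ˡ; ∈-++⁺ʳ; ∈-filter⁺; ∈-filter⁻; ∈-lookup; ∈-allFin)
open import Data.List.Membership.Propositional.Properties.WithK using (unique∧set⇒bag)
open import Data.List.Membership.Setoid.Properties using (index-injective)
open import Data.List.Properties
  using (filter-accept; filter-reject; filter-++; filter-≐; filter-all; filter-notAll;
         length-filter; length-++; length-map; length-tabulate)
open import Data.List.Relation.Binary.BagAndSetEquality using (∼bag⇒↭)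
open import Data.List.Relation.Binary.Permutation.Propositional using (_↭_; ↭-sym)
open import Data.List.Relation.Binary.Permutation.Propositional.Properties using (↭-length; filter-↭)
open import Data.List.Relation.Unary.All using ([]; _∷_)
import Data.List.Relation.Unary.All as All
open import Data.List.Relation.Unary.AllPairs using ([]; _∷_)
open import Data.List.Relation.Unary.Any using (here; there; index)
open import Data.List.Relation.Unary.Unique.Propositional using (Unique)
import Data.List.Relation.Unary.Unique.Propositional.Properties as Unique
open import Data.Maybe using (just)
import Data.Maybe as Maybe
open import Data.Maybe.Properties using (just-injective)
open import Data.Nat using (ℕ; zero; suc; _+_; _*_; _≤_; _^_; _∸_; z≤n; s≤s; s≤s⁻¹)
open import Data.Nat.Properties
  using (^-monoʳ-≤; +-identityʳ; +-comm; +-assoc; +-suc; *-cancelˡ-≡; n≤1+n; 1+n≰n; m^n>0;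
         ≤-refl; ≤-reflexive; ≤-trans; +-mono-≤; +-monoˡ-≤; +-monoʳ-≤; +-cancelˡ-≤;
         module ≤-Reasoning)
open import Data.Product using (Σ; ∃; _×_; _,_; proj₁; proj₂)
open import Data.Sum using (_⊎_; inj₁; inj₂; swap)
open import Data.Vec using ([]; _∷_; lookup; replicate)
open import Data.Vec.Properties
  using (≡-dec; lookup∘updateAt; lookup∘updateAt′; updateAt-updateAt-local; updateAt-id)
open import Function.Base using (_∘_; const; case_of_)
open import Function.Bundles using (mk⇔)
open import Function.Definitions using (Injective)
open import Level using (0ℓ)
open import Relation.Binary.Definitions using (DecidableEquality)
open import Relation.Binary.PropositionalEquality
open import Relation.Nullary using (¬_; Dec; yes; no; contradiction)
open import Relation.Nullary.Decidable using (_⊎-dec_)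
open import Relation.Unary using (Pred; Decidable; _≐_; _∩_; ∁)
open import Relation.Unary.Properties using (∁?; _∩?_; U?)

private
  variable
    d : ℕ

not≢self : ∀ b → not b ≢ b
not≢self b = not-¬ refl ∘ sym

not≡⇒≢ : ∀ {a b} → not a ≡ b → a ≢ b
not≡⇒≢ {a} e e′ = not≢self a (trans e (sym e′))

≢⇒not≡ : ∀ {a b} → a ≢ b → not a ≡ b
≢⇒not≡ {b = b} a≢b = trans (cong not (¬-not a≢b)) (not-involutive b)

flip-involutive : (i : Fin d) (x : QV d) → flip i (flip i x) ≡ x
flip-involutive i x =
  trans (updateAt-updateAt-local i x (not-involutive (lookup x i))) (updateAt-id i x)

flip-sym : (i : Fin d) {x y : QV d} → y ≡ flip i x → x ≡ flip i y
flip-sym i {x} refl = sym (flip-involutive i x)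

flip-injectiveʳ : (i : Fin d) {x y : QV d} → flip i x ≡ flip i y → x ≡ y
flip-injectiveʳ i {x} {y} e =
  trans (sym (flip-involutive i x)) (trans (cong (flip i) e) (flip-involutive i y))

lookup-flip : (i : Fin d) (x : QV d) → lookup (flip i x) i ≡ not (lookup x i)
lookup-flip i x = lookup∘updateAt i x

lookup-flip-≢ : {i j : Fin d} → j ≢ i → (x : QV d) → lookup (flip i x) j ≡ lookup x j
lookup-flip-≢ {i = i} {j} j≢i x = lookup∘updateAt′ j i j≢i x

flip-injectiveˡ : {i j : Fin d} (x : QV d) → flip i x ≡ flip j x → i ≡ j
flip-injectiveˡ {i = i} {j} x e with i ≟ᶠ j
... | yes i≡j = i≡j
... | no i≢j = contradiction
  (trans (sym (lookup-flip i x)) (trans (cong (λ z → lookup z i) e) (lookup-flip-≢ i≢j x)))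
  (not≢self (lookup x i))

parity-flip : (i : Fin d) (x : QV d) → parity (flip i x) ≡ not (parity x)
parity-flip zero    (b ∷ x) = sym (not-distribˡ-xor b (parity x))
parity-flip (suc i) (b ∷ x) =
  trans (cong (b xor_) (parity-flip i x)) (sym (not-distribʳ-xor b (parity x)))

_≟ᵛ_ : DecidableEquality (QV d)
_≟ᵛ_ = ≡-dec _≟ᵇ_

-- the parity of the half-layer in direction k that contains the edge x x^k
halfLayerParity : Fin d → QV d → Bool
halfLayerParity k x = lookup x k xor parity x

halfLayerParity-flip : (k : Fin d) (x : QV d) →
  halfLayerParity k (flip k x) ≡ halfLayerParity k x
halfLayerParity-flip k x = begin
  lookup (flip k x) k xor parity (flip k x) ≡⟨ cong₂ _xor_ (lookup-flip k x) (parity-flip k x) ⟩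
  not (lookup x k) xor not (parity x)       ≡⟨ sym (not-distribˡ-xor (lookup x k) _) ⟩
  not (lookup x k xor not (parity x))       ≡⟨ cong not (sym (not-distribʳ-xor (lookup x k) _)) ⟩
  not (not (halfLayerParity k x))           ≡⟨ not-involutive _ ⟩
  halfLayerParity k x                       ∎
  where open ≡-Reasoning

halfLayerParity-flip-≢ : {j k : Fin d} → k ≢ j → (x : QV d) →
  halfLayerParity k (flip j x) ≡ not (halfLayerParity k x)
halfLayerParity-flip-≢ {j = j} {k} k≢j x =
  trans (cong₂ _xor_ (lookup-flip-≢ k≢j x) (parity-flip j x)) (sym (not-distribʳ-xor (lookup x k) _))

halfLayerParity-Coord : {k : Fin d} {x : QV d} {c π : Bool} →
  lookup x k ≡ c xor π → parity x ≡ π → halfLayerParity k x ≡ c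
halfLayerParity-Coord {k = k} {x} {c} {π} xk px = begin
  lookup x k xor parity x ≡⟨ cong₂ _xor_ xk px ⟩
  (c xor π) xor π   ≡⟨ xor-assoc c π π ⟩
  c xor (π xor π)   ≡⟨ cong (c xor_) (xor-same π) ⟩
  c xor false       ≡⟨ xor-identityʳ c ⟩
  c                 ∎
  where open ≡-Reasoning

HalfLayerThrough : Fin d → QV d → EdgeSet (QV d)
HalfLayerThrough k e = HalfLayer k (halfLayerParity k e)

halfLayer-upper : {k : Fin d} {p : Bool} {x y : QV d} → HalfLayer k p x y → lookup y k ≡ true
halfLayer-upper {k = k} {x = x} (x≡0 , _ , refl) = trans (lookup-flip k x) (cong not x≡0)

halfLayer-partner : {k : Fin d} {p : Bool} {x y : QV d} → HalfLayer k p ∋ₑ x ─ y → y ≡ flip k x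
halfLayer-partner (inj₁ (_ , _ , refl)) = refl
halfLayer-partner {k = k} (inj₂ (_ , _ , x≡yᵏ)) = flip-sym k x≡yᵏ

halfLayer-isMatching : (k : Fin d) (p : Bool) → IsMatching QAdj (HalfLayer k p)
halfLayer-isMatching k p =
  (λ _ _ h → k , proj₂ (proj₂ h)) ,
  (λ _ _ _ h h′ → trans (halfLayer-partner h) (sym (halfLayer-partner h′)))

halfLayer-covers⇒ : {k : Fin d} {p : Bool} {z : QV d} →
  Covers (HalfLayer k p) z → halfLayerParity k z ≡ p
halfLayer-covers⇒ (x , _ , (x≡0 , px , _) , inj₁ refl) = trans (cong (_xor _) x≡0) px
halfLayer-covers⇒ {k = k} (x , _ , (x≡0 , px , refl) , inj₂ refl) =
  trans (halfLayerParity-flip k x) (trans (cong (_xor _) x≡0) px)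

halfLayer-edge : (k : Fin d) {p : Bool} (z : QV d) →
  halfLayerParity k z ≡ p → HalfLayer k p ∋ₑ z ─ flip k z
halfLayer-edge k z hz with lookup z k in z≡
... | false = inj₁ (refl , hz , refl)
... | true  = inj₂ ( trans (lookup-flip k z) (cong not z≡)
                   , trans (parity-flip k z) hz
                   , sym (flip-involutive k z))

endpoint-halfLayerParity : {i : Fin d} {a e : QV d} → (a ≡ e ⊎ a ≡ flip i e) →
  halfLayerParity i a ≡ halfLayerParity i e
endpoint-halfLayerParity         (inj₁ refl) = refl
endpoint-halfLayerParity {i = i} {e = e} (inj₂ refl) = halfLayerParity-flip i e

endpoint-lookup : {i l : Fin d} {a e : QV d} → l ≢ i → (a ≡ e ⊎ a ≡ flip i e) →
  lookup a l ≡ lookup e l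
endpoint-lookup _   (inj₁ refl) = refl
endpoint-lookup {e = e} l≢i (inj₂ refl) = lookup-flip-≢ l≢i e

off-edge : {i l : Fin d} {a z : QV d} → l ≢ i → lookup z l ≢ lookup a l → ¬ (z ≡ a ⊎ z ≡ flip i a)
off-edge _   z≢a (inj₁ refl) = z≢a refl
off-edge {a = a} l≢i z≢a (inj₂ refl) = z≢a (lookup-flip-≢ l≢i a)

almostHalfLayer-edge : {i l : Fin d} {a y : QV d} → l ≢ i →
  halfLayerParity i y ≡ halfLayerParity i a → lookup y l ≢ lookup a l →
  AlmostHalfLayer i a ∋ₑ y ─ flip i y
almostHalfLayer-edge {i = i} {l} {a} {y} l≢i hy y≢a with halfLayer-edge i y hy
... | inj₁ h = inj₁ (_ , halfLayer-edge i a refl , h , off-edge l≢i y≢a)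
... | inj₂ h =
  inj₂ (_ , halfLayer-edge i a refl , h , off-edge l≢i (y≢a ∘ trans (sym (lookup-flip-≢ l≢i y))))

third : ∀ {n} (i k : Fin (3 + n)) → ∃ λ l → l ≢ i × l ≢ k
third zero             zero             = suc zero , (λ ()) , (λ ())
third zero             (suc zero)       = suc (suc zero) , (λ ()) , (λ ())
third zero             (suc (suc _))    = suc zero , (λ ()) , (λ ())
third (suc zero)       zero             = suc (suc zero) , (λ ()) , (λ ())
third (suc zero)       (suc _)          = zero , (λ ()) , (λ ())
third (suc (suc _))    zero             = suc zero , (λ ()) , (λ ())
third (suc (suc _))    (suc _)          = zero , (λ ()) , (λ ())

some-neighbour-off : ∀ {m} (e : QV (3 + m)) (k : Fin (3 + m)) (b : Bool) → ∃ λ j → lookup (flip j e) k ≢ b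
some-neighbour-off e k b with lookup e k ≟ᵇ b | third k k
... | yes eₖ≡b | _ =
  k , λ e′ → not≢self b (trans (cong not (sym eₖ≡b)) (trans (sym (lookup-flip k e)) e′))
... | no eₖ≢b  | l , l≢k , _ = l , λ e′ → eₖ≢b (trans (sym (lookup-flip-≢ (l≢k ∘ sym) e)) e′)

neighbours : QV d → List (QV d)
neighbours {d} e = map (λ j → flip j e) (allFin d)

length-neighbours : (e : QV d) → length (neighbours e) ≡ d
length-neighbours {d} e = trans (length-map _ (allFin d)) (length-tabulate _)

∉-neighbours : {e x : QV d} → x ∉ neighbours e → ∀ j → x ≢ flip j e
∉-neighbours x∉ j refl = x∉ (∈-map⁺ _ (∈-allFin j))

module _ {V : Set} where

  ⊆ₑ-∋ₑ : {F E : EdgeSet V} → F ⊆ₑ E → {x y : V} → F ∋ₑ x ─ y → E ∋ₑ x ─ y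
  ⊆ₑ-∋ₑ F⊆E (inj₁ f) = F⊆E _ _ f
  ⊆ₑ-∋ₑ F⊆E (inj₂ f) = swap (F⊆E _ _ f)

  ∋ₑ⇒Covers : {E : EdgeSet V} {x y : V} → E ∋ₑ x ─ y → Covers E x
  ∋ₑ⇒Covers {x = x} {y} (inj₁ e) = x , y , e , inj₁ refl
  ∋ₑ⇒Covers {x = x} {y} (inj₂ e) = y , x , e , inj₂ refl

  Covers⇒∋ₑ : {E : EdgeSet V} {z : V} → Covers E z → ∃ λ y → E ∋ₑ z ─ y
  Covers⇒∋ₑ (_ , y , e , inj₁ refl) = y , inj₁ e
  Covers⇒∋ₑ (x , _ , e , inj₂ refl) = x , inj₂ e

  matching-unique : {Adj : V → V → Set} {M : EdgeSet V} → IsMatching Adj M →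
    {x y z : V} → M ∋ₑ x ─ y → M ∋ₑ x ─ z → y ≡ z
  matching-unique (_ , unique) = unique _ _ _

matching-adjacent : {M : EdgeSet (QV d)} → IsMatching QAdj M →
  {x y : QV d} → M ∋ₑ x ─ y → ∃ λ i → y ≡ flip i x
matching-adjacent (adj , _) (inj₁ e) = adj _ _ e
matching-adjacent (adj , _) (inj₂ e) with adj _ _ e
... | i , x≡yⁱ = i , flip-sym i x≡yⁱ

ContainsEdges-∋ₑ : {V : Set} {p : List V} {E : EdgeSet V} → ContainsEdges p E →
  {x y : V} → E ∋ₑ x ─ y → UsesEdge p x y
ContainsEdges-∋ₑ contains (inj₁ e) = contains _ _ e
ContainsEdges-∋ₑ contains (inj₂ e) = swap (contains _ _ e)

module _ {A : Set} (_≟_ : DecidableEquality A) where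

  consec? : (xs : List A) (x y : A) → Dec (Consec xs x y)
  consec? []          x y = no λ ()
  consec? (z ∷ [])    x y = no λ { (there ()) }
  consec? (z ∷ w ∷ r) x y with z ≟ x | w ≟ y | consec? (w ∷ r) x y
  ... | yes refl | yes refl | _      = yes here
  ... | _        | _        | yes c  = yes (there c)
  ... | no z≢x   | _        | no ¬c  = no λ { here → z≢x refl ; (there c) → ¬c c }
  ... | yes _    | no w≢y   | no ¬c  = no λ { here → w≢y refl ; (there c) → ¬c c }

  usesEdge? : (xs : List A) (x y : A) → Dec (UsesEdge xs x y)
  usesEdge? xs x y = consec? xs x y ⊎-dec consec? xs y x

module _ {A : Set} where

  Consec⇒∈ˡ : ∀ {xs : List A} {x y} → Consec xs x y → x ∈ xs
  Consec⇒∈ˡ here      = here refl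
  Consec⇒∈ˡ (there c) = there (Consec⇒∈ˡ c)

  Consec⇒∈ʳ : ∀ {xs : List A} {x y} → Consec xs x y → y ∈ xs
  Consec⇒∈ʳ here      = there (here refl)
  Consec⇒∈ʳ (there c) = there (Consec⇒∈ʳ c)

  no-edge-in-singleton : ∀ (w : A) {x y} → ¬ UsesEdge (w ∷ []) x y
  no-edge-in-singleton w (inj₁ (there ()))
  no-edge-in-singleton w (inj₂ (there ()))

  UsesEdge-tail : ∀ {z : A} {t x y} → UsesEdge (z ∷ t) x y → x ≢ z → y ≢ z → UsesEdge t x y
  UsesEdge-tail (inj₁ here)      x≢z _   = contradiction refl x≢z
  UsesEdge-tail (inj₁ (there c)) _   _   = inj₁ c
  UsesEdge-tail (inj₂ here)      _   y≢z = contradiction refl y≢z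
  UsesEdge-tail (inj₂ (there c)) _   _   = inj₂ c

  UsesEdge-head : ∀ {w w′ : A} {t y} → Unique (w ∷ w′ ∷ t) →
    UsesEdge (w ∷ w′ ∷ t) w y → y ≡ w′
  UsesEdge-head _         (inj₁ here)      = refl
  UsesEdge-head (w∉ ∷ _)  (inj₁ (there c)) = contradiction refl (All.lookup w∉ (Consec⇒∈ˡ c))
  UsesEdge-head (w∉ ∷ _)  (inj₂ here)      = contradiction refl (All.lookup w∉ (here refl))
  UsesEdge-head (w∉ ∷ _)  (inj₂ (there c)) = contradiction refl (All.lookup w∉ (Consec⇒∈ʳ c))

  Consec-++⁺ˡ : ∀ {xs ys : List A} {a b} → Consec xs a b → Consec (xs ++ ys) a b
  Consec-++⁺ˡ here      = here
  Consec-++⁺ˡ (there c) = there (Consec-++⁺ˡ c)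

  Consec-++⁺ʳ : ∀ (xs : List A) {ys a b} → Consec ys a b → Consec (xs ++ ys) a b
  Consec-++⁺ʳ []       c = c
  Consec-++⁺ʳ (_ ∷ xs) c = there (Consec-++⁺ʳ xs c)

  Consec-++-junction : ∀ (xs : List A) {ys a b} → last xs ≡ just a → head ys ≡ just b →
    Consec (xs ++ ys) a b
  Consec-++-junction (_ ∷ [])     {_ ∷ _} refl refl = here
  Consec-++-junction (_ ∷ x ∷ xs)         l    h    = there (Consec-++-junction (x ∷ xs) l h)

  Consec-++⁻ : ∀ (xs : List A) {ys a b} → Consec (xs ++ ys) a b →
    Consec xs a b ⊎ Consec ys a b ⊎ (last xs ≡ just a × head ys ≡ just b)
  Consec-++⁻ []           c         = inj₂ (inj₁ c)
  Consec-++⁻ (_ ∷ [])     here      = inj₂ (inj₂ (refl , refl))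
  Consec-++⁻ (_ ∷ [])     (there c) = inj₂ (inj₁ c)
  Consec-++⁻ (_ ∷ _ ∷ _)  here      = inj₁ here
  Consec-++⁻ (_ ∷ x ∷ xs) (there c) with Consec-++⁻ (x ∷ xs) c
  ... | inj₁ c′ = inj₁ (there c′)
  ... | inj₂ r  = inj₂ r

  head-++ : ∀ {xs ys : List A} {a} → head xs ≡ just a → head (xs ++ ys) ≡ just a
  head-++ {_ ∷ _} refl = refl

  last-++ : ∀ (xs : List A) {ys a} → last ys ≡ just a → last (xs ++ ys) ≡ just a
  last-++ []       l = l
  last-++ (x ∷ xs) {ys} l with xs ++ ys | last-++ xs {ys} l
  ... | _ ∷ _ | l′ = l′

module _ {A B : Set} (f : A → B) where

  Consec-map⁺ : ∀ {xs a b} → Consec xs a b → Consec (map f xs) (f a) (f b)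
  Consec-map⁺ here      = here
  Consec-map⁺ (there c) = there (Consec-map⁺ c)

  Consec-map⁻ : ∀ xs {a′ b′} → Consec (map f xs) a′ b′ →
    ∃ λ a → ∃ λ b → Consec xs a b × a′ ≡ f a × b′ ≡ f b
  Consec-map⁻ (x ∷ y ∷ _)  here      = x , y , here , refl , refl
  Consec-map⁻ (_ ∷ xs)     (there c) with Consec-map⁻ xs c
  ... | a , b , c′ , refl , refl = a , b , there c′ , refl , refl

  head-map : ∀ xs {a} → head xs ≡ just a → head (map f xs) ≡ just (f a)
  head-map (_ ∷ _) refl = refl

  last-map : ∀ xs → last (map f xs) ≡ Maybe.map f (last xs)
  last-map []           = refl
  last-map (_ ∷ [])     = refl
  last-map (_ ∷ y ∷ xs) = last-map (y ∷ xs)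

-- Weak excluded middle from (P_d)

parity-replicate-false : ∀ n → parity (replicate n false) ≡ false
parity-replicate-false zero    = refl
parity-replicate-false (suc n) = parity-replicate-false n

-- Take the half-layer H of direction 0 and parity 0 through a = 000…, and keep its edge
-- at a only if A holds and its edge at b = 111 0… only if A fails.  This matching M
-- satisfies none of C1–C3 for a, b, so it lies on a Hamilton path from a to b; whether
-- that path uses each of the two edges is decidable, and it cannot use both, since then
-- it would contain all of H and H witnesses C1.
module HalfLayerSwitchedBy (n : ℕ) (A : Set) where

  o : QV n
  o = replicate n false

  a b b′ : QV (3 + n)
  a  = false ∷ false ∷ false ∷ o
  b  = true ∷ true ∷ true ∷ o
  b′ = false ∷ true ∷ true ∷ o

  H : EdgeSet (QV (3 + n))
  H = HalfLayer zero false

  M : EdgeSet (QV (3 + n))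
  M x y = H x y × (x ≡ a → A) × (x ≡ b′ → ¬ A)

  M-isMatching : IsMatching QAdj M
  M-isMatching = (λ x y m → proj₁ (halfLayer-isMatching zero false) x y (proj₁ m)) ,
    λ x y z m m′ → proj₂ (halfLayer-isMatching zero false) x y z (forget m) (forget m′)
    where
    forget : ∀ {x y} → M ∋ₑ x ─ y → H ∋ₑ x ─ y
    forget (inj₁ m) = inj₁ (proj₁ m)
    forget (inj₂ m) = inj₂ (proj₁ m)

  parity-a : parity a ≡ false
  parity-a = parity-replicate-false n

  parity-b′ : parity b′ ≡ false
  parity-b′ = trans (not-involutive _) (parity-replicate-false n)

  parity-a≢b : parity a ≢ parity b
  parity-a≢b e rewrite parity-replicate-false n with () ← e

  edge-at-a : ∀ {y} → M ∋ₑ a ─ y → A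
  edge-at-a (inj₁ (_ , fromA , _)) = fromA refl
  edge-at-a (inj₂ (h , _)) with () ← halfLayer-upper h

  edge-at-b : ∀ {y} → M ∋ₑ b ─ y → ¬ A
  edge-at-b (inj₁ ((() , _) , _))
  edge-at-b (inj₂ (h , _ , from-b′)) = from-b′ (halfLayer-partner (inj₂ h))

  b≢flip-a : ∀ i → b ≢ flip i a
  b≢flip-a zero    ()
  b≢flip-a (suc i) ()

  M-unobstructed : ¬ (C1 M a b ⊎ C2 M a b ⊎ C3 M a b)
  M-unobstructed (inj₁ (_ , _ , K⊆M , cover-a , cover-b)) =
    edge-at-b (⊆ₑ-∋ₑ K⊆M (proj₂ (Covers⇒∋ₑ cover-b))) (edge-at-a (⊆ₑ-∋ₑ K⊆M (proj₂ (Covers⇒∋ₑ cover-a))))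
  M-unobstructed (inj₂ (inj₁ (i , _ , _ , b≡aⁱ , _))) = b≢flip-a i b≡aⁱ
  M-unobstructed (inj₂ (inj₂ m)) = edge-at-b (swap m) (edge-at-a m)

  H-obstructed : C1 H a b
  H-obstructed = zero , false , (λ _ _ → inj₁) ,
    (a , flip zero a , (refl , parity-a , refl) , inj₁ refl) ,
    (b′ , b , (refl , parity-b′ , refl) , inj₂ refl)

weak-excluded-middle : ∀ n → PropertyP (3 + n) → (A : Set) → ¬ A ⊎ ¬ ¬ A
weak-excluded-middle n propertyP A = decide (proj₂ (propertyP M M-isMatching a b parity-a≢b) M-unobstructed)
  where
  open HalfLayerSwitchedBy n A
  decide : (Σ (List (QV (3 + n))) λ p → IsHamPath QAdj a b p × ContainsEdges p M) → ¬ A ⊎ ¬ ¬ A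
  decide (p , ham , contains) with usesEdge? _≟ᵛ_ p a (flip zero a) | usesEdge? _≟ᵛ_ p b′ b
  ... | no ¬uses-a | _ = inj₁ λ x → ¬uses-a (contains a _ ((refl , parity-a , refl) , const x , λ ()))
  ... | yes _ | no ¬uses-b =
    inj₂ λ ¬x → ¬uses-b (contains b′ b ((refl , parity-b′ , refl) , (λ ()) , const ¬x))
  ... | yes uses-a | yes uses-b =
    ⊥-elim (proj₁ (propertyP H (halfLayer-isMatching zero false) a b parity-a≢b)
                  (p , ham , contains-H) (inj₁ H-obstructed))
    where
    contains-H : ContainsEdges p H
    contains-H x _ h@(_ , _ , refl) with x ≟ᵛ a | x ≟ᵛ b′
    ... | yes refl | _        = uses-a
    ... | no _     | yes refl = uses-b
    ... | no x≢a   | no x≢b′  = contains x _ (h , ⊥-elim ∘ x≢a , ⊥-elim ∘ x≢b′)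

weak-search : ∀ {m} (P : Fin m → Set) → (∀ k → ¬ P k ⊎ ¬ ¬ P k) →
  (∀ k → ¬ P k) ⊎ ∃ λ k → ¬ ¬ P k
weak-search {zero}  P _      = inj₁ λ ()
weak-search {suc m} P decide with decide zero | weak-search (P ∘ suc) (decide ∘ suc)
... | inj₂ ¬¬p₀ | _              = inj₂ (zero , ¬¬p₀)
... | inj₁ _    | inj₂ (k , ¬¬p) = inj₂ (suc k , ¬¬p)
... | inj₁ ¬p₀  | inj₁ ¬p        = inj₁ λ { zero → ¬p₀ ; (suc k) → ¬p k }

-- Counting

count : {A : Set} {P : Pred A 0ℓ} → Decidable P → List A → ℕ
count P? xs = length (filter P? xs)

module _ {A : Set} where

  module _ {P : Pred A 0ℓ} (P? : Decidable P) where

    count-accept : ∀ {x xs} → P x → count P? (x ∷ xs) ≡ suc (count P? xs)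
    count-accept px = cong length (filter-accept P? px)

    count-reject : ∀ {x xs} → ¬ P x → count P? (x ∷ xs) ≡ count P? xs
    count-reject ¬px = cong length (filter-reject P? ¬px)

    count-++ : ∀ xs ys → count P? (xs ++ ys) ≡ count P? xs + count P? ys
    count-++ xs ys = trans (cong length (filter-++ P? xs ys)) (length-++ (filter P? xs))

    count-↭ : ∀ {xs ys} → xs ↭ ys → count P? xs ≡ count P? ys
    count-↭ xs↭ys = ↭-length (filter-↭ P? xs↭ys)

    count-map : {B : Set} (f : B → A) (xs : List B) → count P? (map f xs) ≡ count (P? ∘ f) xs
    count-map f []       = refl
    count-map f (x ∷ xs) with P? (f x)
    ... | yes _ = cong suc (count-map f xs)
    ... | no _  = count-map f xs

    count-cong : {Q : Pred A 0ℓ} (Q? : Decidable Q) → P ≐ Q → ∀ xs → count P? xs ≡ count Q? xs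
    count-cong Q? P≐Q xs = cong length (filter-≐ P? Q? P≐Q xs)

  complete-unique-↭ : {xs ys : List A} → Unique xs → Unique ys →
    (∀ z → z ∈ xs) → (∀ z → z ∈ ys) → xs ↭ ys
  complete-unique-↭ uxs uys all-xs all-ys =
    ∼bag⇒↭ (unique∧set⇒bag uxs uys (λ {z} → mk⇔ (λ _ → all-ys z) (λ _ → all-xs z)))

  ++-map-unique : {B : Set} {f g : B → A} →
    (∀ {x y} → f x ≡ f y → x ≡ y) → (∀ {x y} → g x ≡ g y → x ≡ y) →
    (∀ {x y} → f x ≢ g y) →
    {xs : List B} → Unique xs → Unique (map f xs ++ map g xs)
  ++-map-unique {f = f} {g} f-inj g-inj f≢g uxs =
    Unique.++⁺ (Unique.map⁺ f-inj uxs) (Unique.map⁺ g-inj uxs) disjoint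
    where
    disjoint : ∀ {z} → ¬ (z ∈ map f _ × z ∈ map g _)
    disjoint (z∈f , z∈g) with ∈-map⁻ f z∈f | ∈-map⁻ g z∈g
    ... | _ , _ , refl | _ , _ , fx≡gy = f≢g fx≡gy

  Unique-lookup-injective : {xs : List A} → Unique xs →
    ∀ i j → List.lookup xs i ≡ List.lookup xs j → i ≡ j
  Unique-lookup-injective {_ ∷ _} _        zero    zero    _ = refl
  Unique-lookup-injective {_ ∷ _} (x∉ ∷ _) zero    (suc j) e =
    contradiction e (All.lookup x∉ (∈-lookup j))
  Unique-lookup-injective {_ ∷ _} (x∉ ∷ _) (suc i) zero    e =
    contradiction (sym e) (All.lookup x∉ (∈-lookup i))
  Unique-lookup-injective {_ ∷ _} (_ ∷ u)  (suc i) (suc j) e = cong suc (Unique-lookup-injective u i j e)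

  Unique-⊆⇒length≤ : {xs ys : List A} → Unique xs → (∀ {z} → z ∈ xs → z ∈ ys) →
    length xs ≤ length ys
  Unique-⊆⇒length≤ {xs} {ys} uxs xs⊆ys = injective⇒≤ position-injective
    where
    position : Fin (length xs) → Fin (length ys)
    position i = index (xs⊆ys (∈-lookup i))
    position-injective : Injective _≡_ _≡_ position
    position-injective {i} {j} e =
      Unique-lookup-injective uxs i j (index-injective (setoid A) (xs⊆ys (∈-lookup i)) (xs⊆ys (∈-lookup j)) e)

  module _ {P : Pred A 0ℓ} (P? : Decidable P) where

    count-injection : {xs : List A} {N : ℕ} → Unique xs → N ≤ count P? xs →
      Σ (Fin N → A) λ f → Injective _≡_ _≡_ f × (∀ k → P (f k))
    count-injection {xs} uxs N≤ =
      (λ k → List.lookup (filter P? xs) (inject≤ k N≤)) ,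
      (λ {k} {l} e → inject≤-injective N≤ N≤ k l
                       (Unique-lookup-injective (Unique.filter⁺ P? {xs} uxs) _ _ e)) ,
      (λ k → proj₂ (∈-filter⁻ P? {xs = xs} (∈-lookup (inject≤ k N≤))))

    module _ {Q : Pred A 0ℓ} (Q? : Decidable Q) where

      count-split : ∀ xs → count P? xs ≡ count (P? ∩? Q?) xs + count (P? ∩? ∁? Q?) xs
      count-split []       = refl
      count-split (x ∷ xs) with P? x | Q? x
      ... | yes _ | yes _ = cong suc (count-split xs)
      ... | yes _ | no _  = trans (cong suc (count-split xs)) (sym (+-suc _ _))
      ... | no _  | _     = count-split xs

module _ {A : Set} (_≟_ : DecidableEquality A) {P : Pred A 0ℓ} (P? : Decidable P) where
  open import Data.List.Membership.DecPropositional _≟_ using (_∈?_)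

  count-∉ : {xs : List A} → Unique xs → (L : List A) →
    count P? xs ≤ count (P? ∩? ∁? (_∈? L)) xs + count P? L
  count-∉ {xs} uxs L = subst (count P? xs ≤_) (length-++ (filter (P? ∩? ∁? (_∈? L)) xs))
    (Unique-⊆⇒length≤ (Unique.filter⁺ P? {xs} uxs) split)
    where
    split : ∀ {z} → z ∈ filter P? xs → z ∈ filter (P? ∩? ∁? (_∈? L)) xs ++ filter P? L
    split {z} z∈ with ∈-filter⁻ P? {xs = xs} z∈ | z ∈? L
    ... | z∈xs , pz | yes z∈L = ∈-++⁺ʳ (filter _ xs) (∈-filter⁺ P? {xs = L} z∈L pz)
    ... | z∈xs , pz | no z∉L  = ∈-++⁺ˡ (∈-filter⁺ (P? ∩? ∁? (_∈? L)) {xs = xs} z∈xs (pz , z∉L))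

vertices : ∀ d → List (QV d)
vertices zero    = [] ∷ []
vertices (suc d) = map (true ∷_) (vertices d) ++ map (false ∷_) (vertices d)

∈-vertices : (x : QV d) → x ∈ vertices d
∈-vertices []          = here refl
∈-vertices (true ∷ x)  = ∈-++⁺ˡ (∈-map⁺ (true ∷_) (∈-vertices x))
∈-vertices (false ∷ x) = ∈-++⁺ʳ (map (true ∷_) _) (∈-map⁺ (false ∷_) (∈-vertices x))

vertices-unique : ∀ d → Unique (vertices d)
vertices-unique zero    = [] ∷ []
vertices-unique (suc d) = ++-map-unique (λ { refl → refl }) (λ { refl → refl }) (λ ()) (vertices-unique d)

length-vertices : ∀ d → length (vertices d) ≡ 2 ^ d
length-vertices zero    = refl
length-vertices (suc d) = begin
  length (map (true ∷_) (vertices d) ++ map (false ∷_) (vertices d))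
    ≡⟨ length-++ (map (true ∷_) (vertices d)) ⟩
  length (map (true ∷_) (vertices d)) + length (map (false ∷_) (vertices d))
    ≡⟨ cong₂ _+_ (length-map _ (vertices d)) (length-map _ (vertices d)) ⟩
  length (vertices d) + length (vertices d)
    ≡⟨ cong₂ _+_ (length-vertices d) (trans (length-vertices d) (sym (+-identityʳ _))) ⟩
  2 ^ suc d ∎
  where open ≡-Reasoning

count-vertices : ∀ d → count U? (vertices d) ≡ 2 ^ d
count-vertices d = trans (cong length (filter-all U? (All.universal-U (vertices d)))) (length-vertices d)

count-flip : {P : Pred (QV d) 0ℓ} (P? : Decidable P) (j : Fin d) →
  count P? (vertices d) ≡ count (P? ∘ flip j) (vertices d)
count-flip {d} P? j = trans (count-↭ P? (↭-sym flipped↭)) (count-map P? (flip j) (vertices d))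
  where
  flipped↭ : map (flip j) (vertices d) ↭ vertices d
  flipped↭ = complete-unique-↭ (Unique.map⁺ (flip-injectiveʳ j) (vertices-unique d)) (vertices-unique d)
    (λ z → subst (_∈ map (flip j) (vertices d)) (flip-involutive j z)
                 (∈-map⁺ (flip j) (∈-vertices (flip j z))))
    ∈-vertices

-- Flipping coordinate j preserves R and toggles g, so it exchanges the vertices of R on
-- which g is c with those on which it is not c.
module _ {R : Pred (QV d) 0ℓ} (R? : Decidable R) (j : Fin d) (R-flip : ∀ {x} → R x → R (flip j x))
         (g : QV d → Bool) (g-flip : ∀ x → g (flip j x) ≡ not (g x)) where

  private
    G? : (c : Bool) → Decidable (λ x → g x ≡ c)
    G? c x = g x ≟ᵇ c

  count-halves : ∀ c → count (R? ∩? G? c) (vertices d) ≡ count (R? ∩? ∁? (G? c)) (vertices d)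
  count-halves c = trans (count-flip (R? ∩? G? c) j) (count-cong _ (R? ∩? ∁? (G? c)) (to , from) (vertices d))
    where
    to : ∀ {x} → R (flip j x) × g (flip j x) ≡ c → R x × g x ≢ c
    to {x} (r , e) = subst R (flip-involutive j x) (R-flip r) , not≡⇒≢ (trans (sym (g-flip x)) e)
    from : ∀ {x} → R x × g x ≢ c → R (flip j x) × g (flip j x) ≡ c
    from {x} (r , ne) = R-flip r , trans (g-flip x) (≢⇒not≡ ne)

  count-half : ∀ {m} c → count R? (vertices d) ≡ 2 ^ suc m → count (R? ∩? G? c) (vertices d) ≡ 2 ^ m
  count-half {m} c total = *-cancelˡ-≡ _ _ 2 (begin
    half + (half + 0)
      ≡⟨ cong (half +_) (trans (+-identityʳ half) (count-halves c)) ⟩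
    half + count (R? ∩? ∁? (G? c)) (vertices d)
      ≡⟨ sym (count-split R? (G? c) (vertices d)) ⟩
    count R? (vertices d)
      ≡⟨ total ⟩
    2 * 2 ^ m ∎)
    where
    open ≡-Reasoning
    half : ℕ
    half = count (R? ∩? G? c) (vertices d)

Coord : Fin d → Bool → Pred (QV d) 0ℓ
Coord k b x = lookup x k ≡ b

Coord? : (k : Fin d) (b : Bool) → Decidable (Coord k b)
Coord? k b x = lookup x k ≟ᵇ b

Parity : Bool → Pred (QV d) 0ℓ
Parity π x = parity x ≡ π

Parity? : (π : Bool) → Decidable (Parity {d} π)
Parity? π x = parity x ≟ᵇ π

count-U∩ : {P : Pred (QV d) 0ℓ} (P? : Decidable P) → count (U? ∩? P?) (vertices d) ≡ count P? (vertices d)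
count-U∩ {d} P? = count-cong (U? ∩? P?) P? (proj₂ , (_ ,_)) (vertices d)

count-Parity : ∀ m π → count (Parity? π) (vertices (suc m)) ≡ 2 ^ m
count-Parity m π =
  trans (sym (count-U∩ (Parity? {suc m} π)))
    (count-half {suc m} U? zero _ parity (parity-flip zero) {m} π (count-vertices (suc m)))

count-Coord : ∀ m (k : Fin (suc m)) b → count (Coord? k b) (vertices (suc m)) ≡ 2 ^ m
count-Coord m k b =
  trans (sym (count-U∩ (Coord? k b)))
    (count-half {suc m} U? k _ (λ x → lookup x k) (lookup-flip k) {m} b (count-vertices (suc m)))

count-Coord-Parity : ∀ m (k : Fin (3 + m)) b π →
  count (Coord? k b ∩? Parity? π) (vertices (3 + m)) ≡ 2 ^ (1 + m)
count-Coord-Parity m k b π with third k k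
... | l , l≢k , _ =
  count-half (Coord? k b) l (λ {x} → trans (lookup-flip-≢ (l≢k ∘ sym) x)) parity (parity-flip l) {1 + m} π
    (count-Coord (2 + m) k b)

count-Coord-Coord-Parity : ∀ m {k₁ k₂ : Fin (3 + m)} → k₁ ≢ k₂ → ∀ b₁ b₂ π →
  count ((Coord? k₁ b₁ ∩? Coord? k₂ b₂) ∩? Parity? π) (vertices (3 + m)) ≡ 2 ^ m
count-Coord-Coord-Parity m {k₁} {k₂} k₁≢k₂ b₁ b₂ π with third k₁ k₂
... | l , l≢k₁ , l≢k₂ =
  count-half (Coord? k₁ b₁ ∩? Coord? k₂ b₂) l
    (λ {x} (e₁ , e₂) → trans (lookup-flip-≢ (l≢k₁ ∘ sym) x) e₁ ,
                       trans (lookup-flip-≢ (l≢k₂ ∘ sym) x) e₂)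
    parity (parity-flip l) {m} π
    (count-half (Coord? k₁ b₁) k₂ (λ {x} → trans (lookup-flip-≢ k₁≢k₂ x))
       (λ x → lookup x k₂) (lookup-flip k₂) {1 + m} b₂ (count-Coord (2 + m) k₁ b₁))

4+n≤2^[2+n] : ∀ n → 4 + n ≤ 2 ^ (2 + n)
4+n≤2^[2+n] zero    = ≤-refl
4+n≤2^[2+n] (suc n) = begin
  suc (4 + n)                ≤⟨ +-mono-≤ (m^n>0 2 (2 + n)) (4+n≤2^[2+n] n) ⟩
  2 ^ (2 + n) + 2 ^ (2 + n)  ≡⟨ cong (2 ^ (2 + n) +_) (sym (+-identityʳ _)) ⟩
  2 ^ (3 + n)                ∎
  where open ≤-Reasoning

2^[3+n]≤c+[4+n]⇒2^[2+n]≤c : ∀ n c → 2 ^ (3 + n) ≤ c + (4 + n) → 2 ^ (2 + n) ≤ c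
2^[3+n]≤c+[4+n]⇒2^[2+n]≤c n c h = +-cancelˡ-≤ (2 ^ (2 + n)) _ _ (begin
  2 ^ (2 + n) + 2 ^ (2 + n)  ≡⟨ cong (2 ^ (2 + n) +_) (sym (+-identityʳ _)) ⟩
  2 ^ (3 + n)                ≤⟨ h ⟩
  c + (4 + n)                ≤⟨ +-monoʳ-≤ c (4+n≤2^[2+n] n) ⟩
  c + 2 ^ (2 + n)            ≡⟨ +-comm c _ ⟩
  2 ^ (2 + n) + c            ∎)
  where open ≤-Reasoning

2^[4+n]≤c+[5+n]+[5+n]⇒2^[2+n]≤c : ∀ n c → 2 ^ (4 + n) ≤ c + ((5 + n) + (5 + n)) → 2 ^ (2 + n) ≤ c
2^[4+n]≤c+[5+n]+[5+n]⇒2^[2+n]≤c n c h =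
  2^[3+n]≤c+[4+n]⇒2^[2+n]≤c n c (+-cancelˡ-≤ (2 ^ (3 + n)) _ _ (begin
  2 ^ (3 + n) + 2 ^ (3 + n)        ≡⟨ cong (2 ^ (3 + n) +_) (sym (+-identityʳ _)) ⟩
  2 ^ (4 + n)                      ≤⟨ h ⟩
  c + ((5 + n) + (5 + n))          ≡⟨ cong (c +_) (+-suc (5 + n) (4 + n)) ⟩
  c + ((6 + n) + (4 + n))          ≤⟨ +-monoʳ-≤ c (+-monoˡ-≤ (4 + n) 6+n≤2^[3+n]) ⟩
  c + (2 ^ (3 + n) + (4 + n))      ≡⟨ sym (+-assoc c _ _) ⟩
  c + 2 ^ (3 + n) + (4 + n)        ≡⟨ cong (_+ (4 + n)) (+-comm c _) ⟩
  2 ^ (3 + n) + c + (4 + n)        ≡⟨ +-assoc (2 ^ (3 + n)) c _ ⟩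
  2 ^ (3 + n) + (c + (4 + n))      ∎))
  where
  open ≤-Reasoning
  6+n≤2^[3+n] : 6 + n ≤ 2 ^ (3 + n)
  6+n≤2^[3+n] = begin
    2 + (4 + n)                 ≤⟨ +-mono-≤ (≤-trans (s≤s (s≤s z≤n)) (4+n≤2^[2+n] n))
                                            (4+n≤2^[2+n] n) ⟩
    2 ^ (2 + n) + 2 ^ (2 + n)   ≡⟨ cong (2 ^ (2 + n) +_) (sym (+-identityʳ _)) ⟩
    2 ^ (3 + n)                 ∎

-- Necessity

-- Along a Partnered Walk, coloured vertices come in adjacent pairs w, σ w and uncoloured
-- ones in runs of length at most 2.
module ColourSurplus {A : Set} (Adj : A → A → Set) (σ : A → A) (σ-involutive : ∀ w → σ (σ w) ≡ w)
  {Col : Pred A 0ℓ} (Col? : Decidable Col) (Col-σ : ∀ {w} → Col w → Col (σ w))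
  (coloured-edge : ∀ {x y} → Adj x y → Col x → Col y → y ≡ σ x)
  (uncoloured-edge : ∀ {x y} → Adj x y → ¬ Col x → ¬ Col y → y ≡ σ x) where

  Walk : List A → Set
  Walk s = ∀ x y → Consec s x y → Adj x y

  Partnered : List A → Set
  Partnered s = ∀ w → w ∈ s → Col w → UsesEdge s w (σ w)

  EndsColoured : List A → Set
  EndsColoured s = ∀ {y} → last s ≡ just y → Col y

  #col #uncol : List A → ℕ
  #col   = count Col?
  #uncol = count (∁? Col?)

  private
    σ-injective : ∀ {x y} → σ x ≡ σ y → x ≡ y
    σ-injective {x} {y} e = trans (sym (σ-involutive x)) (trans (cong σ e) (σ-involutive y))

    Walk-tail : ∀ {z t} → Walk (z ∷ t) → Walk t
    Walk-tail walk x y c = walk x y (there c)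

    Partnered-drop-uncoloured : ∀ {z t} → ¬ Col z → Partnered (z ∷ t) → Partnered t
    Partnered-drop-uncoloured ¬cz part w w∈t cw =
      UsesEdge-tail (part w (there w∈t) cw) (λ { refl → ¬cz cw })
                    (λ σw≡z → ¬cz (subst Col σw≡z (Col-σ cw)))

    Partnered-drop-pair : ∀ {z t} → Unique (z ∷ σ z ∷ t) → Partnered (z ∷ σ z ∷ t) → Partnered t
    Partnered-drop-pair {z} ((_ ∷ z∉t) ∷ σz∉t ∷ _) part w w∈t cw =
      UsesEdge-tail (UsesEdge-tail (part w (there (there w∈t)) cw)
                      (λ w≡z → All.lookup z∉t w∈t (sym w≡z))
                      (λ σw≡z → All.lookup σz∉t w∈t (trans (cong σ (sym σw≡z)) (σ-involutive w))))
                    (λ w≡σz → All.lookup σz∉t w∈t (sym w≡σz))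
                    (λ σw≡σz → All.lookup z∉t w∈t (sym (σ-injective σw≡σz)))

    count-coloured-pair : ∀ {w t} → Col w →
      #col (w ∷ σ w ∷ t) ≡ 2 + #col t × #uncol (w ∷ σ w ∷ t) ≡ #uncol t
    count-coloured-pair c =
      trans (count-accept Col? c) (cong suc (count-accept Col? (Col-σ c))) ,
      trans (count-reject (∁? Col?) (λ ¬c → ¬c c)) (count-reject (∁? Col?) (λ ¬c → ¬c (Col-σ c)))

    count-uncoloured : ∀ {w s} → ¬ Col w → #col (w ∷ s) ≡ #col s × #uncol (w ∷ s) ≡ suc (#uncol s)
    count-uncoloured ¬c = count-reject Col? ¬c , count-accept (∁? Col?) ¬c

  surplus-coloured : ∀ w s → Unique (w ∷ s) → Walk (w ∷ s) → Partnered (w ∷ s) →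
    EndsColoured (w ∷ s) → Col w → 2 + #uncol (w ∷ s) ≤ #col (w ∷ s)
  surplus-after-pair : ∀ w t → Unique (w ∷ σ w ∷ t) → Walk (w ∷ σ w ∷ t) →
    Partnered (w ∷ σ w ∷ t) → EndsColoured (w ∷ σ w ∷ t) → Col w → #uncol t ≤ #col t
  surplus-uncoloured : ∀ w s → Unique (w ∷ s) → Walk (w ∷ s) → Partnered (w ∷ s) →
    EndsColoured (w ∷ s) → ¬ Col w → #uncol (w ∷ s) ≤ #col (w ∷ s)
  surplus-uncoloured-pair : ∀ w w′ t → Unique (w ∷ w′ ∷ t) → Walk (w ∷ w′ ∷ t) →
    Partnered (w ∷ w′ ∷ t) → EndsColoured (w ∷ w′ ∷ t) → ¬ Col w → ¬ Col w′ →
    #uncol (w ∷ w′ ∷ t) ≤ #col (w ∷ w′ ∷ t)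

  surplus-coloured w []      _ _    part _    c = contradiction (part w (here refl) c) (no-edge-in-singleton w)
  surplus-coloured w (_ ∷ t) u walk part ends c with UsesEdge-head u (part w (here refl) c)
  ... | refl = subst₂ _≤_
    (cong (2 +_) (sym (proj₂ (count-coloured-pair c)))) (sym (proj₁ (count-coloured-pair c)))
    (s≤s (s≤s (surplus-after-pair w t u walk part ends c)))

  surplus-after-pair w []      _                            _    _    _    _ = z≤n
  surplus-after-pair w (x ∷ t) u@((_ ∷ w≢x ∷ _) ∷ _ ∷ u′) walk part ends c = case Col? x of λ where
    (yes cx) → contradiction
      (trans (sym (σ-involutive w)) (sym (coloured-edge (walk _ _ (there here)) (Col-σ c) cx))) w≢x
    (no ¬cx) → surplus-uncoloured x t u′ (Walk-tail (Walk-tail walk)) (Partnered-drop-pair u part) ends ¬cx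

  surplus-uncoloured w []       _          _    _    ends ¬c = contradiction (ends refl) ¬c
  surplus-uncoloured w (w′ ∷ t) u@(_ ∷ u′) walk part ends ¬c = case Col? w′ of λ where
    (yes c′) → subst₂ _≤_ (sym (proj₂ (count-uncoloured ¬c))) (sym (proj₁ (count-uncoloured ¬c)))
                 (≤-trans (n≤1+n _)
                   (surplus-coloured w′ t u′ (Walk-tail walk) (Partnered-drop-uncoloured ¬c part) ends c′))
    (no ¬c′) → surplus-uncoloured-pair w w′ t u walk part ends ¬c ¬c′

  surplus-uncoloured-pair w w′ [] _ _ _ ends _ ¬c′ = contradiction (ends refl) ¬c′
  surplus-uncoloured-pair w w′ (x ∷ t) u@((_ ∷ w≢x ∷ _) ∷ _ ∷ u′) walk part ends ¬c ¬c′
    with uncoloured-edge (walk _ _ here) ¬c ¬c′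
  ... | refl = case Col? x of λ where
    (no ¬cx) → contradiction
      (trans (sym (σ-involutive w)) (sym (uncoloured-edge (walk _ _ (there here)) ¬c′ ¬cx))) w≢x
    (yes cx) → subst₂ _≤_
      (sym (trans (proj₂ (count-uncoloured ¬c)) (cong suc (proj₂ (count-uncoloured ¬c′)))))
      (sym (trans (proj₁ (count-uncoloured ¬c)) (proj₁ (count-uncoloured ¬c′))))
      (surplus-coloured x t u′ (Walk-tail (Walk-tail walk))
        (Partnered-drop-uncoloured ¬c′ (Partnered-drop-uncoloured ¬c part)) ends cx)

layerParity-≢ : {s t : Fin 2} → s ≢ t → layerParity t ≡ not (layerParity s)
layerParity-≢ {zero}     {zero}     s≢t = contradiction refl s≢t
layerParity-≢ {zero}     {suc zero} _   = refl
layerParity-≢ {suc zero} {zero}     _   = refl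
layerParity-≢ {suc zero} {suc zero} s≢t = contradiction refl s≢t

inG₁ inG₂ : QV d → GV d
inG₁ x = zero , x
inG₂ x = suc zero , x

gvertices : ∀ d → List (GV d)
gvertices d = map inG₁ (vertices d) ++ map inG₂ (vertices d)

∈-gvertices : (w : GV d) → w ∈ gvertices d
∈-gvertices (zero , x)     = ∈-++⁺ˡ (∈-map⁺ inG₁ (∈-vertices x))
∈-gvertices (suc zero , x) = ∈-++⁺ʳ (map inG₁ _) (∈-map⁺ inG₂ (∈-vertices x))

gvertices-unique : ∀ d → Unique (gvertices d)
gvertices-unique d = ++-map-unique (λ { refl → refl }) (λ { refl → refl }) (λ ()) (vertices-unique d)

flipᴳ : Fin d → GV d → GV d
flipᴳ i (s , x) = s , flip i x

flipᴳ-involutive : (i : Fin d) (w : GV d) → flipᴳ i (flipᴳ i w) ≡ w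
flipᴳ-involutive i (s , x) = cong (s ,_) (flip-involutive i x)

-- w is covered by the sequence of half-layers in direction i and global parity q iff
-- seqClass i w ≡ q
seqClass : Fin d → GV d → Bool
seqClass i (s , x) = layerParity s xor halfLayerParity i x

seqClass-flipᴳ : (i : Fin d) (w : GV d) → seqClass i (flipᴳ i w) ≡ seqClass i w
seqClass-flipᴳ i (s , x) = cong (layerParity s xor_) (halfLayerParity-flip i x)

seqClass-flip-≢ : {i j : Fin d} → j ≢ i → (s : Fin 2) (x : QV d) →
  seqClass i (s , flip j x) ≡ not (seqClass i (s , x))
seqClass-flip-≢ {i = i} j≢i s x =
  trans (cong (layerParity s xor_) (halfLayerParity-flip-≢ (j≢i ∘ sym) x))
        (sym (not-distribʳ-xor (layerParity s) (halfLayerParity i x)))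

seqClass-layer-≢ : (i : Fin d) {s t : Fin 2} → s ≢ t → (x : QV d) →
  seqClass i (t , x) ≡ not (seqClass i (s , x))
seqClass-layer-≢ i {s} s≢t x =
  trans (cong (_xor _) (layerParity-≢ s≢t)) (sym (not-distribˡ-xor (layerParity s) (halfLayerParity i x)))

GAdj-seqClass : (i : Fin d) {w w′ : GV d} → GAdj w w′ → seqClass i w ≡ seqClass i w′ →
  w′ ≡ flipᴳ i w
GAdj-seqClass i {s , x} (inj₁ (refl , j , refl)) e with j ≟ᶠ i
... | yes refl = refl
... | no j≢i   = contradiction (trans e (seqClass-flip-≢ j≢i s x)) (not≢self (seqClass i (s , x)) ∘ sym)
GAdj-seqClass i {s , x} {t , _} (inj₂ (refl , s≢t)) e =
  contradiction (trans e (seqClass-layer-≢ i s≢t x)) (not≢self (seqClass i (s , x)) ∘ sym)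

seqHalfLayers-covers⇒ : {i : Fin d} {q : Bool} {w : GV d} → Covers (SeqHalfLayers i q) w → seqClass i w ≡ q
seqHalfLayers-covers⇒ ((s , x) , _ , (refl , x≡0 , gp , refl) , inj₁ refl) =
  trans (cong (λ c → layerParity s xor (c xor parity x)) x≡0) gp
seqHalfLayers-covers⇒ {i = i} ((s , x) , _ , (refl , x≡0 , gp , refl) , inj₂ refl) =
  trans (seqClass-flipᴳ i (s , x)) (trans (cong (λ c → layerParity s xor (c xor parity x)) x≡0) gp)

seqHalfLayers-edge : (i : Fin d) {q : Bool} (w : GV d) → seqClass i w ≡ q →
  SeqHalfLayers i q ∋ₑ w ─ flipᴳ i w
seqHalfLayers-edge i (s , x) cw with lookup x i in x≡
... | false = inj₁ (refl , refl , cw , refl)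
... | true  = inj₂ ( refl , trans (lookup-flip i x) (cong not x≡)
                   , trans (cong (layerParity s xor_) (parity-flip i x)) cw
                   , sym (flip-involutive i x))

count-gvertices : {P : Pred (GV d) 0ℓ} (P? : Decidable P) →
  count P? (gvertices d) ≡ count (P? ∘ inG₁) (vertices d) + count (P? ∘ inG₂) (vertices d)
count-gvertices {d} P? =
  trans (count-++ P? (map inG₁ (vertices d)) _)
        (cong₂ _+_ (count-map P? inG₁ (vertices d)) (count-map P? inG₂ (vertices d)))

-- seqClass i (1, x) is the negation of seqClass i (2, x).
seqClass-balanced : (i : Fin d) (q : Bool) →
  count (λ w → seqClass i w ≟ᵇ q) (gvertices d) ≡ count (∁? (λ w → seqClass i w ≟ᵇ q)) (gvertices d)
seqClass-balanced {d} i q = begin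
  count Col? (gvertices d)
    ≡⟨ count-gvertices Col? ⟩
  count (Col? ∘ inG₁) (vertices d) + count (Col? ∘ inG₂) (vertices d)
    ≡⟨ cong₂ _+_ (count-cong _ (∁? Col? ∘ inG₂) (not≡⇒≢ , ≢⇒not≡) (vertices d))
                 (count-cong _ (∁? Col? ∘ inG₁)
                    ((λ e e′ → not≡⇒≢ e′ e) , trans (sym (not-involutive _)) ∘ ≢⇒not≡) (vertices d)) ⟩
  count (∁? Col? ∘ inG₂) (vertices d) + count (∁? Col? ∘ inG₁) (vertices d)
    ≡⟨ +-comm (count (∁? Col? ∘ inG₂) (vertices d)) _ ⟩
  count (∁? Col? ∘ inG₁) (vertices d) + count (∁? Col? ∘ inG₂) (vertices d)
    ≡⟨ sym (count-gvertices (∁? Col?)) ⟩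
  count (∁? Col?) (gvertices d) ∎
  where
  open ≡-Reasoning
  Col? : Decidable (λ w → seqClass i w ≡ q)
  Col? w = seqClass i w ≟ᵇ q

seqHalfLayers-⊆ : {k : Fin d} {q : Bool} {M₁ M₂ : EdgeSet (QV d)} →
  HalfLayer k (not q) ⊆ₑ M₁ → HalfLayer k q ⊆ₑ M₂ → SeqHalfLayers k q ⊆ₑ unionM M₁ M₂
seqHalfLayers-⊆ H₁⊆M₁ H₂⊆M₂ (zero , x) (zero , y) (refl , xₖ≡0 , gp , y≡xᵏ)
  with H₁⊆M₁ x y (xₖ≡0 , trans (sym (not-involutive _)) (cong not gp) , y≡xᵏ)
... | inj₁ m = inj₁ (inj₁ (refl , refl , m))
... | inj₂ m = inj₂ (inj₁ (refl , refl , m))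
seqHalfLayers-⊆ H₁⊆M₁ H₂⊆M₂ (suc zero , x) (suc zero , y) (refl , h) with H₂⊆M₂ x y h
... | inj₁ m = inj₁ (inj₂ (refl , refl , m))
... | inj₂ m = inj₂ (inj₂ (refl , refl , m))

HamPathContaining : EdgeSet (GV d) → GV d → GV d → Set
HamPathContaining {d} M w w′ = Σ (List (GV d)) λ p → IsHamPath GAdj w w′ p × ContainsEdges p M

CoveringSequence : EdgeSet (GV d) → GV d → GV d → Set
CoveringSequence {d} M w w′ = Σ (Fin d) λ i → Σ Bool λ q →
  (SeqHalfLayers i q ⊆ₑ M) × Covers (SeqHalfLayers i q) w × Covers (SeqHalfLayers i q) w′

hamPath⇒¬coveringSequence : {M : EdgeSet (GV d)} {w w′ : GV d} →
  HamPathContaining M w w′ → ¬ CoveringSequence M w w′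
hamPath⇒¬coveringSequence ([] , () , _)
hamPath⇒¬coveringSequence {d} (w ∷ s , (refl , last≡ , unique , spanning , walk) , contains)
                              (i , q , S⊆M , cover-w , cover-w′) =
  1+n≰n (≤-trans (n≤1+n _) (subst (2 + #uncol (w ∷ s) ≤_) balanced surplus))
  where
  open ColourSurplus GAdj (flipᴳ i) (flipᴳ-involutive i) (λ z → seqClass i z ≟ᵇ q)
    (λ {z} c → trans (seqClass-flipᴳ i z) c)
    (λ adj c c′ → GAdj-seqClass i adj (trans c (sym c′)))
    (λ adj ¬c ¬c′ → GAdj-seqClass i adj (trans (¬-not ¬c) (sym (¬-not ¬c′))))
  surplus : 2 + #uncol (w ∷ s) ≤ #col (w ∷ s)
  surplus = surplus-coloured w s unique walk
    (λ z _ c → ContainsEdges-∋ₑ contains (⊆ₑ-∋ₑ S⊆M (seqHalfLayers-edge i z c)))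
    (λ e → subst (λ z → seqClass i z ≡ q) (just-injective (trans (sym last≡) e))
                 (seqHalfLayers-covers⇒ cover-w′))
    (seqHalfLayers-covers⇒ cover-w)
  w∷s↭all : w ∷ s ↭ gvertices d
  w∷s↭all = complete-unique-↭ unique (gvertices-unique d) spanning ∈-gvertices
  balanced : #col (w ∷ s) ≡ #uncol (w ∷ s)
  balanced = trans (count-↭ _ w∷s↭all) (trans (seqClass-balanced i q) (sym (count-↭ _ w∷s↭all)))

NoObstruction : EdgeSet (QV d) → QV d → QV d → Set
NoObstruction M a b = ¬ (C1 M a b ⊎ C2 M a b ⊎ C3 M a b)

module _ {n} {M : EdgeSet (QV (3 + n))} (matching : IsMatching QAdj M) {k : Fin (3 + n)} {e : QV (3 + n)}
         (H⊆M : HalfLayerThrough k e ⊆ₑ M) where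

  private
    partner-direction : ∀ {j} → M ∋ₑ e ─ flip j e → j ≡ k
    partner-direction m =
      flip-injectiveˡ e (matching-unique matching m (⊆ₑ-∋ₑ H⊆M (halfLayer-edge k e refl)))

    partner : ∀ {x} → M ∋ₑ e ─ x → halfLayerParity k x ≡ halfLayerParity k e
    partner m with matching-adjacent matching m
    ... | j , refl with partner-direction m
    ... | refl = halfLayerParity-flip k e

    covered-together : ∀ {k′ p x} → HalfLayer k′ p ⊆ₑ M →
      Covers (HalfLayer k′ p) e → Covers (HalfLayer k′ p) x →
      halfLayerParity k x ≡ halfLayerParity k e
    covered-together K⊆M cover-e cover-x with Covers⇒∋ₑ cover-e
    ... | _ , edge with halfLayer-partner edge
    ... | refl with partner-direction (⊆ₑ-∋ₑ K⊆M edge)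
    ... | refl = trans (halfLayer-covers⇒ cover-x) (sym (halfLayer-covers⇒ cover-e))

    -- The vertex y = e^{lki} (l a third direction) lies on an edge of H in direction k
    -- and on an edge of the almost half-layer in direction i.
    no-crossing-almostHalfLayer : ∀ {i a} → i ≢ k → (a ≡ e ⊎ a ≡ flip i e) →
      ¬ (AlmostHalfLayer i a ⊆ₑ M)
    no-crossing-almostHalfLayer {i} {a} i≢k a≈e A⊆M with third i k
    ... | l , l≢i , l≢k = i≢k (sym (flip-injectiveˡ y (matching-unique matching y─yᵏ y─yⁱ)))
      where
      y : QV (3 + n)
      y = flip i (flip k (flip l e))
      hk : halfLayerParity k y ≡ halfLayerParity k e
      hk = begin
        halfLayerParity k y                         ≡⟨ halfLayerParity-flip-≢ (i≢k ∘ sym) (flip k (flip l e)) ⟩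
        not (halfLayerParity k (flip k (flip l e))) ≡⟨ cong not (halfLayerParity-flip k (flip l e)) ⟩
        not (halfLayerParity k (flip l e))          ≡⟨ cong not (halfLayerParity-flip-≢ (l≢k ∘ sym) e) ⟩
        not (not (halfLayerParity k e))             ≡⟨ not-involutive _ ⟩
        halfLayerParity k e                         ∎
        where open ≡-Reasoning
      hi : halfLayerParity i y ≡ halfLayerParity i a
      hi = begin
        halfLayerParity i y                         ≡⟨ halfLayerParity-flip i (flip k (flip l e)) ⟩
        halfLayerParity i (flip k (flip l e))       ≡⟨ halfLayerParity-flip-≢ i≢k (flip l e) ⟩
        not (halfLayerParity i (flip l e))          ≡⟨ cong not (halfLayerParity-flip-≢ (l≢i ∘ sym) e) ⟩
        not (not (halfLayerParity i e))             ≡⟨ not-involutive _ ⟩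
        halfLayerParity i e                         ≡⟨ sym (endpoint-halfLayerParity a≈e) ⟩
        halfLayerParity i a                         ∎
        where open ≡-Reasoning
      yˡ≢aˡ : lookup y l ≢ lookup a l
      yˡ≢aˡ e′ = not≢self (lookup e l) (begin
        not (lookup e l)                            ≡⟨ sym (lookup-flip l e) ⟩
        lookup (flip l e) l                         ≡⟨ sym (lookup-flip-≢ l≢k (flip l e)) ⟩
        lookup (flip k (flip l e)) l                ≡⟨ sym (lookup-flip-≢ l≢i (flip k (flip l e))) ⟩
        lookup y l                                  ≡⟨ e′ ⟩
        lookup a l                                  ≡⟨ endpoint-lookup l≢i a≈e ⟩
        lookup e l                                  ∎)
        where open ≡-Reasoning
      y─yᵏ : M ∋ₑ y ─ flip k y
      y─yᵏ = ⊆ₑ-∋ₑ H⊆M (halfLayer-edge k y hk)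
      y─yⁱ : M ∋ₑ y ─ flip i y
      y─yⁱ = ⊆ₑ-∋ₑ A⊆M (almostHalfLayer-edge l≢i hi yˡ≢aˡ)

  halfLayer⇒noObstruction : ∀ {x} → halfLayerParity k x ≢ halfLayerParity k e →
    NoObstruction M e x × NoObstruction M x e
  halfLayer⇒noObstruction {x} x≁e = from-e , to-e
    where
    from-e : NoObstruction M e x
    from-e (inj₁ (_ , _ , K⊆M , cover-e , cover-x)) = x≁e (covered-together K⊆M cover-e cover-x)
    from-e (inj₂ (inj₁ (i , j , i≢j , refl , A⊆M , e─eʲ , _))) =
      no-crossing-almostHalfLayer (λ { refl → i≢j (sym (partner-direction e─eʲ)) }) (inj₁ refl) A⊆M
    from-e (inj₂ (inj₂ e─x)) = x≁e (partner e─x)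
    to-e : NoObstruction M x e
    to-e (inj₁ (_ , _ , K⊆M , cover-x , cover-e)) = x≁e (covered-together K⊆M cover-e cover-x)
    to-e (inj₂ (inj₁ (i , j , i≢j , e≡xⁱ , A⊆M , _ , e─eʲ))) =
      no-crossing-almostHalfLayer (λ { refl → i≢j (sym (partner-direction e─eʲ)) })
        (inj₂ (flip-sym i e≡xⁱ)) A⊆M
    to-e (inj₂ (inj₂ x─e)) = x≁e (partner (swap x─e))

halfLayer¬¬⇒noObstruction : ∀ {n} {M : EdgeSet (QV (3 + n))} → IsMatching QAdj M → ∀ {k e x} →
  ¬ ¬ (HalfLayerThrough k e ⊆ₑ M) → halfLayerParity k x ≢ halfLayerParity k e →
  NoObstruction M e x × NoObstruction M x e
halfLayer¬¬⇒noObstruction matching ¬¬H⊆M x≁e =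
  (λ c → ¬¬H⊆M λ H⊆M → proj₁ (halfLayer⇒noObstruction matching H⊆M x≁e) c) ,
  (λ c → ¬¬H⊆M λ H⊆M → proj₂ (halfLayer⇒noObstruction matching H⊆M x≁e) c)

noHalfLayer⇒noObstruction : {M : EdgeSet (QV d)} → IsMatching QAdj M → {e x : QV d} →
  (∀ k → ¬ (HalfLayerThrough k e ⊆ₑ M)) → (∀ j → x ≢ flip j e) →
  NoObstruction M e x × NoObstruction M x e
noHalfLayer⇒noObstruction {M = M} matching {e} {x} no-H x≁e = from-e , to-e
  where
  uncovered : ∀ {k p} → HalfLayer k p ⊆ₑ M → ¬ Covers (HalfLayer k p) e
  uncovered {k} K⊆M cover-e with halfLayer-covers⇒ cover-e
  ... | refl = no-H k K⊆M
  not-adjacent : ¬ (M ∋ₑ e ─ x)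
  not-adjacent e─x = let j , x≡eʲ = matching-adjacent matching e─x in x≁e j x≡eʲ
  from-e : NoObstruction M e x
  from-e (inj₁ (_ , _ , K⊆M , cover-e , _))        = uncovered K⊆M cover-e
  from-e (inj₂ (inj₁ (i , _ , _ , x≡eⁱ , _)))     = x≁e i x≡eⁱ
  from-e (inj₂ (inj₂ e─x))                          = not-adjacent e─x
  to-e : NoObstruction M x e
  to-e (inj₁ (_ , _ , K⊆M , _ , cover-e))          = uncovered K⊆M cover-e
  to-e (inj₂ (inj₁ (i , _ , _ , e≡xⁱ , _)))       = x≁e i (flip-sym i e≡xⁱ)
  to-e (inj₂ (inj₂ x─e))                            = not-adjacent (swap x─e)

-- Sufficiency and the count of Hamilton paths

module Join {M₁ M₂ : EdgeSet (QV d)} {u x v : QV d} {p₁ p₂ : List (QV d)}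
  (ham₁ : IsHamPath QAdj u x p₁) (contains₁ : ContainsEdges p₁ M₁)
  (ham₂ : IsHamPath QAdj x v p₂) (contains₂ : ContainsEdges p₂ M₂) where

  path : List (GV d)
  path = map inG₁ p₁ ++ map inG₂ p₂

  private
    head₁ : head p₁ ≡ just u
    head₁ = proj₁ ham₁
    last₁ : last p₁ ≡ just x
    last₁ = proj₁ (proj₂ ham₁)
    unique₁ : Unique p₁
    unique₁ = proj₁ (proj₂ (proj₂ ham₁))
    spanning₁ : ∀ y → y ∈ p₁
    spanning₁ = proj₁ (proj₂ (proj₂ (proj₂ ham₁)))
    adjacent₁ : ∀ a b → Consec p₁ a b → QAdj a b
    adjacent₁ = proj₂ (proj₂ (proj₂ (proj₂ ham₁)))
    head₂ : head p₂ ≡ just x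
    head₂ = proj₁ ham₂
    last₂ : last p₂ ≡ just v
    last₂ = proj₁ (proj₂ ham₂)
    unique₂ : Unique p₂
    unique₂ = proj₁ (proj₂ (proj₂ ham₂))
    spanning₂ : ∀ y → y ∈ p₂
    spanning₂ = proj₁ (proj₂ (proj₂ (proj₂ ham₂)))
    adjacent₂ : ∀ a b → Consec p₂ a b → QAdj a b
    adjacent₂ = proj₂ (proj₂ (proj₂ (proj₂ ham₂)))

    last-layer₁ : last (map inG₁ p₁) ≡ just (zero , x)
    last-layer₁ = trans (last-map inG₁ p₁) (cong (Maybe.map inG₁) last₁)

    head-layer₂ : head (map inG₂ p₂) ≡ just (suc zero , x)
    head-layer₂ = head-map inG₂ p₂ head₂

    step : ∀ {a b} → Consec path a b →
      (∃ λ a′ → ∃ λ b′ → Consec p₁ a′ b′ × a ≡ (zero , a′) × b ≡ (zero , b′)) ⊎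
      (∃ λ a′ → ∃ λ b′ → Consec p₂ a′ b′ × a ≡ (suc zero , a′) × b ≡ (suc zero , b′)) ⊎
      (a ≡ (zero , x) × b ≡ (suc zero , x))
    step c with Consec-++⁻ (map inG₁ p₁) c
    ... | inj₁ c₁               = inj₁ (Consec-map⁻ inG₁ p₁ c₁)
    ... | inj₂ (inj₁ c₂)        = inj₂ (inj₁ (Consec-map⁻ inG₂ p₂ c₂))
    ... | inj₂ (inj₂ (l , h))   =
      inj₂ (inj₂ (just-injective (trans (sym l) last-layer₁) , just-injective (trans (sym h) head-layer₂)))

  path-isHamPath : IsHamPath GAdj (zero , u) (suc zero , v) path
  path-isHamPath = first , final , unique , spanning , adjacent
    where
    first : head path ≡ just (zero , u)
    first = head-++ (head-map inG₁ p₁ head₁)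
    final : last path ≡ just (suc zero , v)
    final = last-++ (map inG₁ p₁) (trans (last-map inG₂ p₂) (cong (Maybe.map inG₂) last₂))
    unique : Unique path
    unique = Unique.++⁺ (Unique.map⁺ (λ { refl → refl }) unique₁) (Unique.map⁺ (λ { refl → refl }) unique₂)
                        λ (∈₁ , ∈₂) → case ∈-map⁻ inG₁ ∈₁ , ∈-map⁻ inG₂ ∈₂ of λ where
                          ((_ , _ , refl) , (_ , _ , ())) 
    spanning : ∀ w → w ∈ path
    spanning (zero , y)     = ∈-++⁺ˡ (∈-map⁺ inG₁ (spanning₁ y))
    spanning (suc zero , y) = ∈-++⁺ʳ (map inG₁ p₁) (∈-map⁺ inG₂ (spanning₂ y))
    adjacent : ∀ a b → Consec path a b → GAdj a b
    adjacent _ _ c with step c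
    ... | inj₁ (a , b , c₁ , refl , refl)        = inj₁ (refl , adjacent₁ a b c₁)
    ... | inj₂ (inj₁ (a , b , c₂ , refl , refl)) = inj₁ (refl , adjacent₂ a b c₂)
    ... | inj₂ (inj₂ (refl , refl))              = inj₂ (refl , λ ())

  path-contains : ContainsEdges path (unionM M₁ M₂)
  path-contains (zero , a) (zero , b) (inj₁ (refl , refl , m)) with contains₁ a b m
  ... | inj₁ c = inj₁ (Consec-++⁺ˡ (Consec-map⁺ inG₁ c))
  ... | inj₂ c = inj₂ (Consec-++⁺ˡ (Consec-map⁺ inG₁ c))
  path-contains (suc zero , a) (suc zero , b) (inj₂ (refl , refl , m)) with contains₂ a b m
  ... | inj₁ c = inj₁ (Consec-++⁺ʳ (map inG₁ p₁) (Consec-map⁺ inG₂ c))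
  ... | inj₂ c = inj₂ (Consec-++⁺ʳ (map inG₁ p₁) (Consec-map⁺ inG₂ c))

  path-crossing : UsesExactlyCrossing path x
  path-crossing = inj₁ junction , only
    where
    junction : Consec path (zero , x) (suc zero , x)
    junction = Consec-++-junction (map inG₁ p₁) last-layer₁ head-layer₂
    only : ∀ y → UsesEdge path (zero , y) (suc zero , y) → y ≡ x
    only y (inj₁ c) with step c
    ... | inj₁ (_ , _ , _ , _ , ())
    ... | inj₂ (inj₁ (_ , _ , _ , () , _))
    ... | inj₂ (inj₂ (refl , _)) = refl
    only y (inj₂ c) with step c
    ... | inj₁ (_ , _ , _ , () , _)
    ... | inj₂ (inj₁ (_ , _ , _ , _ , ()))
    ... | inj₂ (inj₂ (() , _))

module Crossings {n : ℕ} (propertyP : PropertyP (5 + n))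
  {M₁ M₂ : EdgeSet (QV (5 + n))} (matching₁ : IsMatching QAdj M₁) (matching₂ : IsMatching QAdj M₂)
  {u v : QV (5 + n)} (u≁v : globalParity (zero , u) ≢ globalParity (suc zero , v)) where

  open import Data.List.Membership.DecPropositional (_≟ᵛ_ {5 + n}) using (_∈?_)

  π : Bool
  π = globalParity (zero , u)

  Good : QV (5 + n) → Set
  Good x = parity x ≡ π × NoObstruction M₁ u x × NoObstruction M₂ x v

  CrossingPath : QV (5 + n) → Set
  CrossingPath x = Σ (List (GV (5 + n))) λ p →
    IsHamPath GAdj (zero , u) (suc zero , v) p × ContainsEdges p (unionM M₁ M₂) × UsesExactlyCrossing p x

  crossingPath : ∀ {x} → Good x → CrossingPath x
  crossingPath {x} (px , free₁ , free₂) =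
    join (proj₂ (propertyP M₁ matching₁ u x u≢x) free₁)
         (proj₂ (propertyP M₂ matching₂ x v x≢v) free₂)
    where
    u≢x : parity u ≢ parity x
    u≢x e = not≢self (parity u) (sym (trans e px))
    x≢v : parity x ≢ parity v
    x≢v e = u≁v (trans (sym px) e)
    join : (Σ (List (QV (5 + n))) λ p → IsHamPath QAdj u x p × ContainsEdges p M₁) →
           (Σ (List (QV (5 + n))) λ p → IsHamPath QAdj x v p × ContainsEdges p M₂) → CrossingPath x
    join (_ , ham₁ , contains₁) (_ , ham₂ , contains₂) = path , path-isHamPath , path-contains , path-crossing
      where open Join ham₁ contains₁ ham₂ contains₂

  GoodCrossings : Set
  GoodCrossings = Σ (Fin (2 ^ (2 + n)) → QV (5 + n)) λ f → Injective _≡_ _≡_ f × (∀ k → Good (f k))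

  CrossingPaths : Set
  CrossingPaths = Σ (Fin (2 ^ (2 + n)) → List (GV (5 + n))) λ path → Σ (Fin (2 ^ (2 + n)) → QV (5 + n)) λ cross →
    ((k : Fin (2 ^ (2 + n))) →
       IsHamPath GAdj (zero , u) (suc zero , v) (path k) × ContainsEdges (path k) (unionM M₁ M₂) ×
       UsesExactlyCrossing (path k) (cross k)) ×
    Injective _≡_ _≡_ cross

  crossingPaths : GoodCrossings → CrossingPaths
  crossingPaths (cross , cross-injective , good) =
    (λ k → proj₁ (crossingPath (good k))) , cross , (λ k → proj₂ (crossingPath (good k))) ,
    λ {k l} → cross-injective {k} {l}

  halfLayer-dichotomy : (M : EdgeSet (QV (5 + n))) (e : QV (5 + n)) →
    (∀ k → ¬ (HalfLayerThrough k e ⊆ₑ M)) ⊎ ∃ λ k → ¬ ¬ (HalfLayerThrough k e ⊆ₑ M)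
  halfLayer-dichotomy M e = weak-search _ (λ k → weak-excluded-middle (2 + n) propertyP _)

  private
    crossings-from : {F : Pred (QV (5 + n)) 0ℓ} (F? : Decidable F) → (∀ {x} → F x → Good x) →
      2 ^ (2 + n) ≤ count F? (vertices (5 + n)) → GoodCrossings
    crossings-from F? sound bound with count-injection F? (vertices-unique (5 + n)) bound
    ... | f , f-injective , f∈F = f , f-injective , sound ∘ f∈F

    -- the value of coordinate k that puts a vertex of parity π off the half-layer in
    -- direction k through e
    avoid : Fin (5 + n) → QV (5 + n) → Bool
    avoid k e = not (halfLayerParity k e) xor π

    avoids : ∀ k e {x} → Coord k (avoid k e) x → parity x ≡ π → halfLayerParity k x ≢ halfLayerParity k e
    avoids k e {x} xₖ px e′ =
      not≢self (halfLayerParity k e) (trans (sym (halfLayerParity-Coord {k = k} {x} xₖ px)) e′)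

    module _ (k : Fin (5 + n)) (x : QV (5 + n)) where

      safe-half-layer₁ : ¬ ¬ (HalfLayerThrough k u ⊆ₑ M₁) → Coord k (avoid k u) x → parity x ≡ π →
        NoObstruction M₁ u x
      safe-half-layer₁ ¬¬H xₖ px =
        proj₁ (halfLayer¬¬⇒noObstruction matching₁ ¬¬H (avoids k u {x} xₖ px))

      safe-half-layer₂ : ¬ ¬ (HalfLayerThrough k v ⊆ₑ M₂) → Coord k (avoid k v) x → parity x ≡ π →
        NoObstruction M₂ x v
      safe-half-layer₂ ¬¬H xₖ px =
        proj₂ (halfLayer¬¬⇒noObstruction matching₂ ¬¬H (avoids k v {x} xₖ px))

    count-avoiding-neighbours : ∀ k b e →
      2 ^ (2 + n) ≤ count ((Coord? k b ∩? Parity? π) ∩? ∁? (_∈? neighbours e)) (vertices (5 + n))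
    count-avoiding-neighbours k b e = 2^[3+n]≤c+[4+n]⇒2^[2+n]≤c n _ (begin
      2 ^ (3 + n)                                            ≡⟨ sym (count-Coord-Parity (2 + n) k b π) ⟩
      count CP? (vertices (5 + n))                           ≤⟨ count-∉ _≟ᵛ_ CP? (vertices-unique _) _ ⟩
      count F? (vertices (5 + n)) + count CP? (neighbours e) ≤⟨ +-monoʳ-≤ _ few ⟩
      count F? (vertices (5 + n)) + (4 + n)                  ∎)
      where
      open ≤-Reasoning
      CP? : Decidable (Coord k b ∩ Parity π)
      CP? = Coord? k b ∩? Parity? π
      F? : Decidable ((Coord k b ∩ Parity π) ∩ ∁ (_∈ neighbours e))
      F? = CP? ∩? ∁? (_∈? neighbours e)
      few : count CP? (neighbours e) ≤ 4 + n
      few with some-neighbour-off e k b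
      ... | j , off = s≤s⁻¹ (subst (suc (count CP? (neighbours e)) ≤_) (length-neighbours e)
                        (filter-notAll CP? (neighbours e) (lose (∈-map⁺ _ (∈-allFin j)) (off ∘ proj₁))))

    count-avoiding-two-neighbourhoods : ∀ e e′ →
      2 ^ (2 + n) ≤ count (Parity? π ∩? ∁? (_∈? neighbours e ++ neighbours e′)) (vertices (5 + n))
    count-avoiding-two-neighbourhoods e e′ = 2^[4+n]≤c+[5+n]+[5+n]⇒2^[2+n]≤c n _ (begin
      2 ^ (4 + n)                                            ≡⟨ sym (count-Parity (4 + n) π) ⟩
      count (Parity? π) (vertices (5 + n))                   ≤⟨ count-∉ _≟ᵛ_ (Parity? π) (vertices-unique _) L ⟩
      count F? (vertices (5 + n)) + count (Parity? π) L      ≤⟨ +-monoʳ-≤ _ (length-filter (Parity? π) L) ⟩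
      count F? (vertices (5 + n)) + length L                 ≡⟨ cong (count F? (vertices (5 + n)) +_) length-L ⟩
      count F? (vertices (5 + n)) + ((5 + n) + (5 + n))      ∎)
      where
      open ≤-Reasoning
      L : List (QV (5 + n))
      L = neighbours e ++ neighbours e′
      F? : Decidable (Parity π ∩ ∁ (_∈ L))
      F? = Parity? π ∩? ∁? (_∈? L)
      length-L : length L ≡ (5 + n) + (5 + n)
      length-L = trans (length-++ (neighbours e)) (cong₂ _+_ (length-neighbours e) (length-neighbours e′))

  crossings-two-directions : ∀ {k₁ k₂} → k₁ ≢ k₂ →
    ¬ ¬ (HalfLayerThrough k₁ u ⊆ₑ M₁) → ¬ ¬ (HalfLayerThrough k₂ v ⊆ₑ M₂) → GoodCrossings
  crossings-two-directions {k₁} {k₂} k₁≢k₂ ¬¬H₁ ¬¬H₂ =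
    crossings-from ((Coord? k₁ (avoid k₁ u) ∩? Coord? k₂ (avoid k₂ v)) ∩? Parity? π)
      (λ {x} ((x₁ , x₂) , px) → px , safe-half-layer₁ k₁ x ¬¬H₁ x₁ px
                                   , safe-half-layer₂ k₂ x ¬¬H₂ x₂ px)
      (≤-reflexive (sym (count-Coord-Coord-Parity (2 + n) k₁≢k₂ _ _ π)))

  crossings-one-direction : ∀ {k} → halfLayerParity k u ≡ halfLayerParity k v →
    ¬ ¬ (HalfLayerThrough k u ⊆ₑ M₁) → ¬ ¬ (HalfLayerThrough k v ⊆ₑ M₂) → GoodCrossings
  crossings-one-direction {k} u∼v ¬¬H₁ ¬¬H₂ =
    crossings-from (Coord? k (avoid k u) ∩? Parity? π)
      (λ {x} (xₖ , px) → px , safe-half-layer₁ k x ¬¬H₁ xₖ px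
                            , safe-half-layer₂ k x ¬¬H₂ (trans xₖ (cong (λ h → not h xor π) u∼v)) px)
      (≤-trans (^-monoʳ-≤ 2 (n≤1+n (2 + n))) (≤-reflexive (sym (count-Coord-Parity (2 + n) k _ π))))

  crossings-half-layer-at-u : ∀ {k} → ¬ ¬ (HalfLayerThrough k u ⊆ₑ M₁) →
    (∀ k → ¬ (HalfLayerThrough k v ⊆ₑ M₂)) → GoodCrossings
  crossings-half-layer-at-u {k} ¬¬H₁ no-H₂ =
    crossings-from ((Coord? k (avoid k u) ∩? Parity? π) ∩? ∁? (_∈? neighbours v))
      (λ {x} ((xₖ , px) , x∉) → px , safe-half-layer₁ k x ¬¬H₁ xₖ px
                                   , proj₂ (noHalfLayer⇒noObstruction matching₂ no-H₂ (∉-neighbours x∉)))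
      (count-avoiding-neighbours k _ v)

  crossings-half-layer-at-v : ∀ {k} → (∀ k → ¬ (HalfLayerThrough k u ⊆ₑ M₁)) →
    ¬ ¬ (HalfLayerThrough k v ⊆ₑ M₂) → GoodCrossings
  crossings-half-layer-at-v {k} no-H₁ ¬¬H₂ =
    crossings-from ((Coord? k (avoid k v) ∩? Parity? π) ∩? ∁? (_∈? neighbours u))
      (λ {x} ((xₖ , px) , x∉) → px , proj₁ (noHalfLayer⇒noObstruction matching₁ no-H₁ (∉-neighbours x∉))
                                   , safe-half-layer₂ k x ¬¬H₂ xₖ px)
      (count-avoiding-neighbours k _ u)

  crossings-no-half-layer : (∀ k → ¬ (HalfLayerThrough k u ⊆ₑ M₁)) →
    (∀ k → ¬ (HalfLayerThrough k v ⊆ₑ M₂)) → GoodCrossings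
  crossings-no-half-layer no-H₁ no-H₂ =
    crossings-from (Parity? π ∩? ∁? (_∈? neighbours u ++ neighbours v))
      (λ (px , x∉) →
         px , proj₁ (noHalfLayer⇒noObstruction matching₁ no-H₁ (∉-neighbours (x∉ ∘ ∈-++⁺ˡ)))
            , proj₂ (noHalfLayer⇒noObstruction matching₂ no-H₂ (∉-neighbours (x∉ ∘ ∈-++⁺ʳ (neighbours u)))))
      (count-avoiding-two-neighbourhoods u v)

  halfLayers⇒coveringSequence : ∀ {k} → halfLayerParity k u ≢ halfLayerParity k v →
    HalfLayerThrough k u ⊆ₑ M₁ → HalfLayerThrough k v ⊆ₑ M₂ →
    CoveringSequence (unionM M₁ M₂) (zero , u) (suc zero , v)
  halfLayers⇒coveringSequence {k} u≁ᵏv H₁ H₂ =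
    k , halfLayerParity k v ,
    seqHalfLayers-⊆ (subst (λ p → HalfLayer k p ⊆ₑ M₁) (¬-not u≁ᵏv) H₁) H₂ ,
    ∋ₑ⇒Covers (seqHalfLayers-edge k (zero , u) (≢⇒not≡ u≁ᵏv)) ,
    ∋ₑ⇒Covers (seqHalfLayers-edge k (suc zero , v) refl)

  goodCrossings : ¬ CoveringSequence (unionM M₁ M₂) (zero , u) (suc zero , v) → GoodCrossings
  goodCrossings ¬cover with halfLayer-dichotomy M₁ u | halfLayer-dichotomy M₂ v
  ... | inj₁ no-H₁        | inj₁ no-H₂        = crossings-no-half-layer no-H₁ no-H₂
  ... | inj₁ no-H₁        | inj₂ (_ , ¬¬H₂)   = crossings-half-layer-at-v no-H₁ ¬¬H₂
  ... | inj₂ (_ , ¬¬H₁)   | inj₁ no-H₂        = crossings-half-layer-at-u ¬¬H₁ no-H₂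
  ... | inj₂ (k₁ , ¬¬H₁)  | inj₂ (k₂ , ¬¬H₂) with k₁ ≟ᶠ k₂
  ...   | no k₁≢k₂ = crossings-two-directions k₁≢k₂ ¬¬H₁ ¬¬H₂
  ...   | yes refl with halfLayerParity k₁ u ≟ᵇ halfLayerParity k₁ v
  ...     | yes u∼v = crossings-one-direction u∼v ¬¬H₁ ¬¬H₂
  ...     | no u≁ᵏv =
    ⊥-elim (¬¬H₁ λ H₁ → ¬¬H₂ λ H₂ → ¬cover (halfLayers⇒coveringSequence u≁ᵏv H₁ H₂))

lemma4 : (d : ℕ) → 5 ≤ d →
    (M₁ M₂ : EdgeSet (QV d)) → IsMatching QAdj M₁ → IsMatching QAdj M₂ →
    (u v : QV d) → globalParity (zero , u) ≢ globalParity (suc zero , v) →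
    PropertyP d →
    (((Σ (List (GV d)) λ p → IsHamPath GAdj (zero , u) (suc zero , v) p × ContainsEdges p (unionM M₁ M₂)) →
        ¬ (Σ (Fin d) λ i → Σ _ λ q → (SeqHalfLayers i q ⊆ₑ unionM M₁ M₂) ×
             Covers (SeqHalfLayers i q) (zero , u) × Covers (SeqHalfLayers i q) (suc zero , v))) ×
     (¬ (Σ (Fin d) λ i → Σ _ λ q → (SeqHalfLayers i q ⊆ₑ unionM M₁ M₂) ×
             Covers (SeqHalfLayers i q) (zero , u) × Covers (SeqHalfLayers i q) (suc zero , v)) →
        Σ (List (GV d)) λ p → IsHamPath GAdj (zero , u) (suc zero , v) p × ContainsEdges p (unionM M₁ M₂))) ×
    ((Σ (List (GV d)) λ p → IsHamPath GAdj (zero , u) (suc zero , v) p × ContainsEdges p (unionM M₁ M₂)) →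
       Σ (Fin (2 ^ (d ∸ 3)) → List (GV d)) λ path → Σ (Fin (2 ^ (d ∸ 3)) → QV d) λ cross →
         ((k : Fin (2 ^ (d ∸ 3))) →
            IsHamPath GAdj (zero , u) (suc zero , v) (path k) ×
            ContainsEdges (path k) (unionM M₁ M₂) ×
            UsesExactlyCrossing (path k) (cross k)) ×
         Injective _≡_ _≡_ cross)
lemma4 (suc (suc (suc (suc (suc n))))) (s≤s (s≤s (s≤s (s≤s (s≤s z≤n)))))
       M₁ M₂ matching₁ matching₂ u v u≁v propertyP =
  (hamPath⇒¬coveringSequence , hamPath) , crossingPaths ∘ goodCrossings ∘ hamPath⇒¬coveringSequence
  where
  open Crossings propertyP matching₁ matching₂ {u} {v} u≁v
  hamPath : ¬ CoveringSequence (unionM M₁ M₂) (zero , u) (suc zero , v) →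
    HamPathContaining (unionM M₁ M₂) (zero , u) (suc zero , v)
  hamPath ¬cover =
    let _ , _ , good = goodCrossings ¬cover
        p , ham , contains , _ = crossingPath (good (fromℕ< (m^n>0 2 (2 + n))))
    in p , ham , contains
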